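{- Let $u$ be a palindrome with $|u|\geq2$ that is a factor of $c_\alpha$, and let $\mathrm{occ}_i(u)$ denote the position of the $i$-th occurrence of $u$ in $c_\alpha$. (1) Suppose $u=vU_{n,k}\widetilde{v}$ for some $n\geq1$, where $v$ is a suffix of $v_{n-2}$, $v\neq v_{n-2}$, and $0\leq k\leq d_{n+1}-2$. Then $\mathrm{occ}_1(u)=\frac12\big((k+2)q_n+q_{n-1}-|u|-2\big)$ and, for all $i\geq1$, $\mathrm{occ}_{i+1}(u)=\mathrm{occ}_i(u)+P_i$, where $(P_i)_{i\geq1}$ is $c_{\alpha_{n,-k}}\{q_n,(k+1)q_n+q_{n-1}\}$. (2) Suppose $u=v\overline{U}_{n,k}\widetilde{v}$ for some $n\geq1$, where $v$ is a suffix of $w_{n-1}$, $v\neq w_{n-1}$, and $0\leq k\leq d_{n+1}-1$. Then $\mathrm{occ}_1(u)=\frac12\big((k+1)q_n+q_{n-1}-|u|-2\big)$ and, for all $i\geq1$, $\mathrm{occ}_{i+1}(u)=\mathrm{occ}_i(u)+P_i$, where $(P_i)_{i\geq1}$ is $c_{\alpha_{n,1-k}}\{q_n,kq_n+q_{n-1}\}$. Moreover, if $u=a^k$ for some integer $k\in[2,d_1-1]$, then $\mathrm{occ}_1(u)=0$ and $\mathrm{occ}_{i+1}(u)=\mathrm{occ}_i(u)+P_i$ for all $i\ge1$, where $(P_i)_{i\geq1}$ is $c_{\alpha_{0,-k}}\{1,k+1\}$.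
   Context: Words are over $\{a,b\}$; $\varepsilon$ is the empty word; $\widetilde{x}$ is the reversal of $x$; a palindrome satisfies $x=\widetilde{x}$. Positions in an infinite word $x_0x_1\cdots$ start at $0$; $u$ occurs at position $p$ if $x_p\cdots x_{p+|u|-1}=u$. Formal inverses $x^{ -1}$ of words are taken in the free group on $\{a,b\}$. For an irrational $\gamma\in(0,1)$, $c_\gamma$ is the infinite word with $c_\gamma(n)=a$ if $\lfloor (n+2)\gamma\rfloor-\lfloor (n+1)\gamma\rfloor=0$ and $b$ otherwise ($n\ge0$). For $\gamma=[0;a_1,a_2,\ldots]$, $n\in\mathbb{N}$ and integer $k\geq1-a_{n+1}$, $\gamma_{n,k}=[0;a_{n+1}+k,a_{n+2},\ldots]$. For an infinite word $\mathbf{c}$ over $\{a,b\}$, $\mathbf{c}\{x,y\}$ is obtained by replacing $a$ by $x$ and $b$ by $y$ (here $x,y$ are integers, giving an integer sequence). Standing assumption: $\alpha=[0;1+d_1,d_2,d_3,\ldots]$ irrational with all integers $d_i\geq1$. $s_{ -1}=b$, $s_0=a$, $s_n=s_{n-1}^{d_n}s_{n-2}$ ($n\ge1$); $q_n=|s_n|$ for $n\ge0$ and $q_{ -1}=1$; $c_\alpha=\lim s_n$. Singular words: $w_{ -2}=\varepsilon$, $w_{ -1}=a$, for $n\ge0$: $w_n=as_nb^{ -1}$ ($n$ odd), $w_n=bs_na^{ -1}$ ($n$ even). Adjoining singular words: $v_{ -2}=\varepsilon$, for $n\ge-1$: $v_n=as_{n+1}^{d_{n+2}-1}s_nb^{ -1}$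 ($n$ odd), $v_n=bs_{n+1}^{d_{n+2}-1}s_na^{ -1}$ ($n$ even). For $n\ge0$, $0\le k\le d_{n+1}-1$: $U_{n,k}=(w_{n-1}v_{n-2})^kw_{n-1}$, $\overline{U}_{n,k}=(v_{n-2}w_{n-1})^kv_{n-2}$. -}

module Defs where

open import Data.Bool using (Bool; true; false; if_then_else_; _∧_)
open import Data.Nat using (ℕ; zero; suc; _+_; _*_; _∸_; _≤_)
open import Data.Integer as ℤ using (ℤ; +_; ∣_∣)
open import Data.List using (List; []; _∷_; _++_; length; reverse; replicate; concat)
open import Data.Product using (Σ; _×_; _,_; ∃)
open import Relation.Binary.PropositionalEquality using (_≡_)

data Letter : Set where
  a b : Letter

Word : Set
Word = List Letter

-- infinite words x₀x₁⋯ , positions start at 0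
InfWord : Set
InfWord = ℕ → Letter

_==L_ : Letter → Letter → Bool
a ==L a = true
b ==L b = true
_ ==L _ = false

_^w_ : Word → ℕ → Word
x ^w k = concat (replicate k x)

-- formal right cancellation of the last letter:  x ⋅ ℓ⁻¹  for a word x
-- ending with ℓ (all uses below are of this kind, so the free-group
-- product is the positive word obtained by deleting the last letter).
dropLast : Word → Word
dropLast []           = []
dropLast (x ∷ [])     = []
dropLast (x ∷ y ∷ t)  = x ∷ dropLast (y ∷ t)

isEven : ℕ → Bool
isEven zero          = true
isEven (suc zero)    = false
isEven (suc (suc n)) = isEven n

Palindrome : Word → Set
Palindrome x = reverse x ≡ x

Suffix : Word → Word → Set
Suffix v w = Σ Word λ t → t ++ v ≡ w

matches : InfWord → ℕ → Word → Bool
matches x p []      = true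
matches x p (ℓ ∷ u) = (x p ==L ℓ) ∧ matches x (suc p) u

OccursAt : InfWord → Word → ℕ → Set
OccursAt x u p = matches x p u ≡ true

Factor : Word → InfWord → Set
Factor u x = Σ ℕ λ p → OccursAt x u p

countOcc : InfWord → Word → ℕ → ℕ
countOcc x u zero    = 0
countOcc x u (suc p) = countOcc x u p + (if matches x p u then 1 else 0)

-- Occ x u i p  :  occ_i(u) = p, i.e. p is the position of the i-th
-- occurrence (i ≥ 1) of u in x.
Occ : InfWord → Word → ℕ → ℕ → Set
Occ x u i p = OccursAt x u p × suc (countOcc x u p) ≡ i

-- Characteristic Sturmian words from continued fractions.
-- An irrational γ = [0; a₁, a₂, …] is represented by its sequence of
-- partial quotients  cf : ℕ → ℕ  (cf i = aᵢ for i ≥ 1; cf 0 unused).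

-- exponents of the standard words: s₁ = s₀^(a₁-1) s₋₁, sₙ = sₙ₋₁^(aₙ) sₙ₋₂
stdExp : (ℕ → ℕ) → ℕ → ℕ
stdExp cf (suc zero) = cf 1 ∸ 1
stdExp cf n          = cf n

-- stdSh cf m = s_{m-1}  (so stdSh cf 0 = s₋₁ = b, stdSh cf 1 = s₀ = a)
stdSh : (ℕ → ℕ) → ℕ → Word
stdSh cf zero          = b ∷ []
stdSh cf (suc zero)    = a ∷ []
stdSh cf (suc (suc m)) = (stdSh cf (suc m) ^w stdExp cf (suc m)) ++ stdSh cf m

lookupD : Word → ℕ → Letter
lookupD []      _       = a
lookupD (x ∷ t) zero    = x
lookupD (x ∷ t) (suc i) = lookupD t i

-- c_γ = lim sₙ :  the i-th letter is read off s_{i+1}, whose length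
-- q_{i+1} ≥ i+2 exceeds i whenever a₁ ≥ 2 and aⱼ ≥ 1 (γ ∈ (0,1/2)),
-- which holds for every γ this file uses.
charWord : (ℕ → ℕ) → InfWord
charWord cf i = lookupD (stdSh cf (suc (suc i))) i

-- γ_{n,k} = [0; a_{n+1}+k, a_{n+2}, …]   (for k ≥ 1 - a_{n+1})
cfShift : (ℕ → ℕ) → ℕ → ℤ → (ℕ → ℕ)
cfShift cf n k (suc zero) = ∣ (+ cf (suc n)) ℤ.+ k ∣
cfShift cf n k j          = cf (n + j)

-- c{x,y} : replace a by x and b by y
subst2 : InfWord → ℕ → ℕ → ℕ → ℕ
subst2 c x y i with c i
... | a = x
... | b = y

-- The standing setting: α = [0; 1+d₁, d₂, d₃, …]  (d 0 unused)

alphaCF : (ℕ → ℕ) → (ℕ → ℕ)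
alphaCF d (suc zero) = suc (d 1)
alphaCF d j          = d j

cα : (ℕ → ℕ) → InfWord
cα d = charWord (alphaCF d)

-- sₙ for n ≥ 0   (s₀ = a, s₁ = a^{d₁} b, sₙ = sₙ₋₁^{dₙ} sₙ₋₂)
s : (ℕ → ℕ) → ℕ → Word
s d n = stdSh (alphaCF d) (suc n)

q : (ℕ → ℕ) → ℕ → ℕ
q d n = length (s d n)

-- singular words wₙ for n ≥ 0:
--   wₙ = a sₙ b⁻¹ (n odd),  wₙ = b sₙ a⁻¹ (n even)
w : (ℕ → ℕ) → ℕ → Word
w d n = (if isEven n then b else a) ∷ dropLast (s d n)

-- adjoining singular words, shifted: vSh d m = v_{m-1}  (m ≥ 0, i.e. n = m-1 ≥ -1)
--   vₙ = a s_{n+1}^{d_{n+2}-1} sₙ b⁻¹ (n odd),  vₙ = b s_{n+1}^{d_{n+2}-1} sₙ a⁻¹ (n even)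
-- (n = m-1 is odd iff m is even; sₙ = s_{m-1} = stdSh _ m, s_{n+1} = s_m)
vSh : (ℕ → ℕ) → ℕ → Word
vSh d m = (if isEven m then a else b)
          ∷ ((s d m ^w (d (suc m) ∸ 1)) ++ dropLast (stdSh (alphaCF d) m))

-- for n ≥ 1, 0 ≤ k:  U_{n,k} = (w_{n-1} v_{n-2})^k w_{n-1}
U : (ℕ → ℕ) → ℕ → ℕ → Word
U d n k = ((w d (n ∸ 1) ++ vSh d (n ∸ 1)) ^w k) ++ w d (n ∸ 1)

-- Ū_{n,k} = (v_{n-2} w_{n-1})^k v_{n-2}
Ubar : (ℕ → ℕ) → ℕ → ℕ → Word
Ubar d n k = ((vSh d (n ∸ 1) ++ w d (n ∸ 1)) ^w k) ++ vSh d (n ∸ 1)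

{-# OPTIONS --safe #-}
-- Write φₑ for the morphism a ↦ aᵉb, b ↦ a. For α = [0; 1+d₁, d₂, …] and α′ = [0; 1+d₂, d₃, …]
-- we have c_α = φ_{d₁}(c_{α′}), and φ_{d₁} carries the standard and singular words of α′ at
-- level n − 1 to those of α at level n, up to a conjugating factor a^{d₁}. Every b of c_α is
-- preceded, and (as c_{α′} has no factor bb) followed, by a^{d₁}; so occurrences of φ(u′)a^{d₁}
-- in c_α start at block boundaries and correspond one-to-one to occurrences of u′ in c_{α′}.
-- Hence the sequence of occurrences of u′ (first position, and gaps coded by a Sturmian word G)
-- carries over to u, positions and gaps transforming linearly in the letter counts. Descending
-- to level 0, where u′ is a power aᵐ whose occurrences in φₑ(y) are coded by G = φ_{e−m}(y),
-- gives the occurrences of U_{n,k}, Ū_{n,k} and of their longest palindromic extensions; a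
-- palindrome v U ṽ between the two has the occurrences of U shifted by |v|.
module Submission where

open import Defs
open import Data.Bool using (true; false; not; if_then_else_)
open import Data.Nat
open import Data.Nat.Properties
open import Data.List using (List; []; _∷_; _++_; length; reverse; replicate; drop)
open import Data.List.Properties
  using (++-assoc; ++-identityʳ; length-++; length-replicate; length-reverse; reverse-++)
open import Data.Product using (Σ; _×_; _,_; proj₁; proj₂)
open import Data.Sum using (_⊎_; inj₁; inj₂)
open import Function using (_∘_)
open import Data.Empty using (⊥-elim)
open import Relation.Binary.PropositionalEquality
open import Relation.Binary.Definitions using (tri<; tri≈; tri>)
open import Relation.Nullary using (¬_; yes; no)
open import Data.Nat.Tactic.RingSolver using (solve-∀)

==L⇒≡ : ∀ {x y} → (x ==L y) ≡ true → x ≡ y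
==L⇒≡ {a} {a} _ = refl
==L⇒≡ {b} {b} _ = refl

==L-refl : ∀ x → (x ==L x) ≡ true
==L-refl a = refl
==L-refl b = refl

a≢b : a ≢ b
a≢b ()

δ : Letter → Letter → ℕ
δ a a = 1
δ b b = 1
δ _ _ = 0

infix 10 ∣_∣_

∣_∣_ : Word → Letter → ℕ
∣ [] ∣ l = 0
∣ x ∷ w ∣ l = δ l x + ∣ w ∣ l

count-++ : ∀ x y l → ∣ x ++ y ∣ l ≡ ∣ x ∣ l + ∣ y ∣ l
count-++ [] y l = refl
count-++ (x ∷ xs) y l = trans (cong (δ l x +_) (count-++ xs y l)) (sym (+-assoc (δ l x) _ _))

count-aⁿ-a : ∀ m → ∣ replicate m a ∣ a ≡ m
count-aⁿ-a zero = refl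
count-aⁿ-a (suc m) = cong suc (count-aⁿ-a m)

count-aⁿ-b : ∀ m → ∣ replicate m a ∣ b ≡ 0
count-aⁿ-b zero = refl
count-aⁿ-b (suc m) = count-aⁿ-b m

count-replicate : ∀ m (l₀ : Letter) l → ∣ replicate m l₀ ∣ l ≡ m * ∣ l₀ ∷ [] ∣ l
count-replicate zero l₀ l = refl
count-replicate (suc m) l₀ l =
  trans (cong (δ l l₀ +_) (count-replicate m l₀ l)) (cong (_+ m * ∣ l₀ ∷ [] ∣ l) (sym (+-identityʳ _)))

length≡count-a+count-b : ∀ x → length x ≡ ∣ x ∣ a + ∣ x ∣ b
length≡count-a+count-b [] = refl
length≡count-a+count-b (a ∷ x) = cong suc (length≡count-a+count-b x)
length≡count-a+count-b (b ∷ x) = trans (cong suc (length≡count-a+count-b x)) (sym (+-suc _ _))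

module _ {A : Set} where

  replicate-+ : ∀ m n (x : A) → replicate (m + n) x ≡ replicate m x ++ replicate n x
  replicate-+ zero n x = refl
  replicate-+ (suc m) n x = cong (x ∷_) (replicate-+ m n x)

  replicate-∷ : ∀ m (x : A) w → replicate m x ++ x ∷ w ≡ x ∷ replicate m x ++ w
  replicate-∷ zero x w = refl
  replicate-∷ (suc m) x w = cong (x ∷_) (replicate-∷ m x w)

  replicate-suc-snoc : ∀ m (x : A) → replicate (suc m) x ≡ replicate m x ++ x ∷ []
  replicate-suc-snoc m x = sym (trans (replicate-∷ m x []) (cong (x ∷_) (++-identityʳ _)))

  reverse-replicate : ∀ m (x : A) → reverse (replicate m x) ≡ replicate m x
  reverse-replicate zero x = refl
  reverse-replicate (suc m) x = begin
    reverse (x ∷ replicate m x)         ≡⟨ reverse-++ (x ∷ []) (replicate m x) ⟩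
    reverse (replicate m x) ++ x ∷ []   ≡⟨ cong (_++ x ∷ []) (reverse-replicate m x) ⟩
    replicate m x ++ x ∷ []             ≡⟨ replicate-suc-snoc m x ⟨
    x ∷ replicate m x                   ∎
    where open ≡-Reasoning

  ++-assoc₄ : ∀ (u v w z : List A) → ((u ++ v) ++ w) ++ z ≡ u ++ (v ++ (w ++ z))
  ++-assoc₄ u v w z = trans (++-assoc (u ++ v) w z) (++-assoc u v (w ++ z))

a^w≡replicate : ∀ m → (a ∷ []) ^w m ≡ replicate m a
a^w≡replicate zero = refl
a^w≡replicate (suc m) = cong (a ∷_) (a^w≡replicate m)

if-true : ∀ {A : Set} {c} (x y : A) → c ≡ true → (if c then x else y) ≡ x
if-true x y refl = refl

if-false : ∀ {A : Set} {c} (x y : A) → c ≡ false → (if c then x else y) ≡ y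
if-false x y refl = refl

isEven-suc : ∀ n → isEven (suc n) ≡ not (isEven n)
isEven-suc zero = refl
isEven-suc (suc zero) = refl
isEven-suc (suc (suc n)) = isEven-suc n

dropLast-snoc : ∀ t (l : Letter) → dropLast (t ++ l ∷ []) ≡ t
dropLast-snoc [] l = refl
dropLast-snoc (x ∷ []) l = refl
dropLast-snoc (x ∷ y ∷ t) l = cong (x ∷_) (dropLast-snoc (y ∷ t) l)

module _ {x : InfWord} where

  occursAt-∷⁻ : ∀ {l} u {p} → OccursAt x (l ∷ u) p → x p ≡ l × OccursAt x u (suc p)
  occursAt-∷⁻ {l} u {p} h with x p ==L l in eq | matches x (suc p) u
  ... | true | true = ==L⇒≡ eq , refl

  occursAt-∷⁺ : ∀ {l} u {p} → x p ≡ l → OccursAt x u (suc p) → OccursAt x (l ∷ u) p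
  occursAt-∷⁺ u {p} refl h rewrite ==L-refl (x p) = h

  occursAt-++⁻ : ∀ u v {p} → OccursAt x (u ++ v) p → OccursAt x u p × OccursAt x v (p + length u)
  occursAt-++⁻ [] v {p} h rewrite +-identityʳ p = refl , h
  occursAt-++⁻ (l ∷ u) v {p} h with occursAt-∷⁻ (u ++ v) h
  ... | xp , h′ with occursAt-++⁻ u v h′
  ... | hu , hv rewrite +-suc p (length u) = occursAt-∷⁺ u xp hu , hv

  occursAt-++⁺ : ∀ u v {p} → OccursAt x u p → OccursAt x v (p + length u) → OccursAt x (u ++ v) p
  occursAt-++⁺ [] v {p} hu hv rewrite +-identityʳ p = hv
  occursAt-++⁺ (l ∷ u) v {p} hu hv with occursAt-∷⁻ u hu
  ... | xp , hu′ rewrite +-suc p (length u) = occursAt-∷⁺ (u ++ v) xp (occursAt-++⁺ u v hu′ hv)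

  occursAt-replicate⁻ : ∀ m l {p} → OccursAt x (replicate m l) p → ∀ j → j < m → x (p + j) ≡ l
  occursAt-replicate⁻ (suc m) l {p} h zero _ = trans (cong x (+-identityʳ p)) (proj₁ (occursAt-∷⁻ (replicate m l) h))
  occursAt-replicate⁻ (suc m) l {p} h (suc j) (s≤s j<m) =
    trans (cong x (+-suc p j)) (occursAt-replicate⁻ m l (proj₂ (occursAt-∷⁻ (replicate m l) h)) j j<m)

  occursAt-replicate⁺ : ∀ m l {p} → (∀ j → j < m → x (p + j) ≡ l) → OccursAt x (replicate m l) p
  occursAt-replicate⁺ zero l h = refl
  occursAt-replicate⁺ (suc m) l {p} h =
    occursAt-∷⁺ (replicate m l) (trans (cong x (sym (+-identityʳ p))) (h 0 z<s))
                (occursAt-replicate⁺ m l λ j j<m → trans (cong x (sym (+-suc p j))) (h (suc j) (s≤s j<m)))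

  lookup⇒occursAt : ∀ u {p} → (∀ j → j < length u → x (p + j) ≡ lookupD u j) → OccursAt x u p
  lookup⇒occursAt [] h = refl
  lookup⇒occursAt (l ∷ u) {p} h =
    occursAt-∷⁺ u (trans (cong x (sym (+-identityʳ p))) (h 0 z<s))
                (lookup⇒occursAt u λ j j<u → trans (cong x (sym (+-suc p j))) (h (suc j) (s≤s j<u)))

occursAt-cong : ∀ {x y : InfWord} u {p} → (∀ i → x i ≡ y i) → OccursAt x u p → OccursAt y u p
occursAt-cong [] x≗y h = refl
occursAt-cong {x} {y} (l ∷ u) {p} x≗y h with occursAt-∷⁻ {x} u h
... | xp , h′ = occursAt-∷⁺ {y} u (trans (sym (x≗y p)) xp) (occursAt-cong u x≗y h′)

factor : InfWord → ℕ → ℕ → Word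
factor x t zero = []
factor x t (suc g) = x t ∷ factor x (suc t) g

length-factor : ∀ x t g → length (factor x t g) ≡ g
length-factor x t zero = refl
length-factor x t (suc g) = cong suc (length-factor x (suc t) g)

factor-occursAt : ∀ x t g → OccursAt x (factor x t g) t
factor-occursAt x t zero = refl
factor-occursAt x t (suc g) = occursAt-∷⁺ {x} (factor x (suc t) g) refl (factor-occursAt x (suc t) g)

occursAt⇒factor : ∀ {x : InfWord} u {t} → OccursAt x u t → factor x t (length u) ≡ u
occursAt⇒factor [] h = refl
occursAt⇒factor {x} (l ∷ u) h with occursAt-∷⁻ {x} u h
... | xt , h′ = cong₂ _∷_ xt (occursAt⇒factor u h′)

factor-+ : ∀ x t g h → factor x t (g + h) ≡ factor x t g ++ factor x (t + g) h
factor-+ x t zero h = cong (λ s → factor x s h) (sym (+-identityʳ t))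
factor-+ x t (suc g) h =
  cong (x t ∷_) (trans (factor-+ x (suc t) g h) (cong (λ s → factor x (suc t) g ++ factor x s h) (sym (+-suc t g))))

occursAt⇒letter : ∀ {x : InfWord} u {l} v {t} → OccursAt x (u ++ l ∷ v) t → x (t + length u) ≡ l
occursAt⇒letter {x} u v h = proj₁ (occursAt-∷⁻ {x} v (proj₂ (occursAt-++⁻ u (_ ∷ v) h)))

occursAt-middle : ∀ {x : InfWord} u r s → OccursAt x (replicate r a ++ u ++ replicate r a) s → OccursAt x u (s + r)
occursAt-middle {x} u r s h = subst (OccursAt x u) (cong (s +_) (length-replicate r))
  (proj₁ (occursAt-++⁻ u (replicate r a) (proj₂ (occursAt-++⁻ (replicate r a) (u ++ replicate r a) h))))

factor-aʳ : ∀ {x : InfWord} r {t} → OccursAt x (replicate r a) t → factor x t r ≡ replicate r a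
factor-aʳ {x} r {t} h = trans (cong (factor x t) (sym (length-replicate r))) (occursAt⇒factor (replicate r a) h)

-- The morphism φₑ : a ↦ aᵉb, b ↦ a

φ₁ : ℕ → Letter → Word
φ₁ e a = replicate e a ++ b ∷ []
φ₁ e b = a ∷ []

φ : ℕ → Word → Word
φ e [] = []
φ e (l ∷ w) = φ₁ e l ++ φ e w

φ-++ : ∀ e x y → φ e (x ++ y) ≡ φ e x ++ φ e y
φ-++ e [] y = refl
φ-++ e (l ∷ x) y = trans (cong (φ₁ e l ++_) (φ-++ e x y)) (sym (++-assoc (φ₁ e l) (φ e x) (φ e y)))

φ-^w : ∀ e x k → φ e (x ^w k) ≡ φ e x ^w k
φ-^w e x zero = refl
φ-^w e x (suc k) = trans (φ-++ e x (x ^w k)) (cong (φ e x ++_) (φ-^w e x k))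

φ-snoc-a : ∀ e t → φ e (t ++ a ∷ []) ≡ (φ e t ++ replicate e a) ++ b ∷ []
φ-snoc-a e t = begin
  φ e (t ++ a ∷ [])                           ≡⟨ φ-++ e t (a ∷ []) ⟩
  φ e t ++ ((replicate e a ++ b ∷ []) ++ [])  ≡⟨ cong (φ e t ++_) (++-identityʳ _) ⟩
  φ e t ++ (replicate e a ++ b ∷ [])          ≡⟨ ++-assoc (φ e t) _ _ ⟨
  (φ e t ++ replicate e a) ++ b ∷ []          ∎
  where open ≡-Reasoning

φ-snoc-b : ∀ e t → φ e (t ++ b ∷ []) ≡ φ e t ++ a ∷ []
φ-snoc-b e t = φ-++ e t (b ∷ [])

count-a-φ : ∀ e x → ∣ φ e x ∣ a ≡ e * ∣ x ∣ a + ∣ x ∣ b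
count-a-φ e [] = sym (trans (+-identityʳ _) (*-zeroʳ e))
count-a-φ e (a ∷ x) = begin
  ∣ φ₁ e a ++ φ e x ∣ a                        ≡⟨ count-++ (φ₁ e a) (φ e x) a ⟩
  ∣ replicate e a ++ b ∷ [] ∣ a + ∣ φ e x ∣ a
    ≡⟨ cong₂ _+_ (trans (count-++ (replicate e a) _ a) (trans (+-identityʳ _) (count-aⁿ-a e))) (count-a-φ e x) ⟩
  e + (e * ∣ x ∣ a + ∣ x ∣ b)                  ≡⟨ sym (+-assoc e _ _) ⟩
  e + e * ∣ x ∣ a + ∣ x ∣ b                    ≡⟨ cong (_+ ∣ x ∣ b) (*-suc e _) ⟨
  e * suc (∣ x ∣ a) + ∣ x ∣ b                  ∎
  where open ≡-Reasoning
count-a-φ e (b ∷ x) = trans (cong suc (count-a-φ e x)) (sym (+-suc _ _))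

count-b-φ : ∀ e x → ∣ φ e x ∣ b ≡ ∣ x ∣ a
count-b-φ e [] = refl
count-b-φ e (a ∷ x) = begin
  ∣ φ₁ e a ++ φ e x ∣ b                        ≡⟨ count-++ (φ₁ e a) (φ e x) b ⟩
  ∣ replicate e a ++ b ∷ [] ∣ b + ∣ φ e x ∣ b
    ≡⟨ cong₂ _+_ (trans (count-++ (replicate e a) _ b) (cong (_+ 1) (count-aⁿ-b e))) (count-b-φ e x) ⟩
  suc (∣ x ∣ a)                                ∎
  where open ≡-Reasoning
count-b-φ e (b ∷ x) = count-b-φ e x

length-φ : ∀ e x → length (φ e x) ≡ length x + e * ∣ x ∣ a
length-φ e x = begin
  length (φ e x)                     ≡⟨ length≡count-a+count-b (φ e x) ⟩
  ∣ φ e x ∣ a + ∣ φ e x ∣ b          ≡⟨ cong₂ _+_ (count-a-φ e x) (count-b-φ e x) ⟩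
  e * ∣ x ∣ a + ∣ x ∣ b + ∣ x ∣ a    ≡⟨ rearrange (e * ∣ x ∣ a) (∣ x ∣ a) (∣ x ∣ b) ⟩
  ∣ x ∣ a + ∣ x ∣ b + e * ∣ x ∣ a    ≡⟨ cong (_+ e * ∣ x ∣ a) (length≡count-a+count-b x) ⟨
  length x + e * ∣ x ∣ a             ∎
  where
  open ≡-Reasoning
  rearrange : ∀ p m n → p + n + m ≡ m + n + p
  rearrange = solve-∀

φ-aᵉ-prefix : ∀ e u → Σ Word λ r → φ e u ++ replicate e a ≡ replicate e a ++ r
φ-aᵉ-prefix e [] = [] , sym (++-identityʳ _)
φ-aᵉ-prefix e (a ∷ u) =
  b ∷ (φ e u ++ replicate e a) ,
  trans (++-assoc (replicate e a ++ b ∷ []) (φ e u) _) (++-assoc (replicate e a) (b ∷ []) _)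
φ-aᵉ-prefix e (b ∷ u) with φ-aᵉ-prefix e u
... | r , eq = a ∷ r , trans (cong (a ∷_) eq) (sym (replicate-∷ e a r))

reverse-φ : ∀ e x → replicate e a ++ reverse (φ e x) ≡ φ e (reverse x) ++ replicate e a
reverse-φ e [] = ++-identityʳ _
reverse-φ e (l ∷ x) = begin
  aᵉ ++ reverse (φ₁ e l ++ φ e x)                 ≡⟨ cong (aᵉ ++_) (reverse-++ (φ₁ e l) (φ e x)) ⟩
  aᵉ ++ (reverse (φ e x) ++ reverse (φ₁ e l))     ≡⟨ ++-assoc aᵉ _ _ ⟨
  (aᵉ ++ reverse (φ e x)) ++ reverse (φ₁ e l)     ≡⟨ cong (_++ reverse (φ₁ e l)) (reverse-φ e x) ⟩
  (φ e (reverse x) ++ aᵉ) ++ reverse (φ₁ e l)     ≡⟨ ++-assoc (φ e (reverse x)) _ _ ⟩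
  φ e (reverse x) ++ (aᵉ ++ reverse (φ₁ e l))     ≡⟨ cong (φ e (reverse x) ++_) (letter l) ⟩
  φ e (reverse x) ++ (φ₁ e l ++ aᵉ)               ≡⟨ ++-assoc (φ e (reverse x)) _ _ ⟨
  (φ e (reverse x) ++ φ₁ e l) ++ aᵉ
    ≡⟨ cong (_++ aᵉ) (trans (φ-++ e (reverse x) (l ∷ [])) (cong (φ e (reverse x) ++_) (++-identityʳ _))) ⟨
  φ e (reverse x ++ l ∷ []) ++ aᵉ                 ≡⟨ cong (λ z → φ e z ++ aᵉ) (reverse-++ (l ∷ []) x) ⟨
  φ e (reverse (l ∷ x)) ++ aᵉ                     ∎
  where
  open ≡-Reasoning
  aᵉ = replicate e a
  letter : ∀ l → aᵉ ++ reverse (φ₁ e l) ≡ φ₁ e l ++ aᵉ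
  letter a = begin
    aᵉ ++ reverse (aᵉ ++ b ∷ [])   ≡⟨ cong (aᵉ ++_) (reverse-++ aᵉ (b ∷ [])) ⟩
    aᵉ ++ b ∷ reverse aᵉ           ≡⟨ cong (λ z → aᵉ ++ b ∷ z) (reverse-replicate e a) ⟩
    aᵉ ++ b ∷ aᵉ                   ≡⟨ ++-assoc aᵉ (b ∷ []) _ ⟨
    (aᵉ ++ b ∷ []) ++ aᵉ           ∎
  letter b = trans (replicate-∷ e a []) (cong (a ∷_) (++-identityʳ _))

_≗⁺_ : (ℕ → ℕ) → (ℕ → ℕ) → Set
cf ≗⁺ cf′ = ∀ j → cf (suc j) ≡ cf′ (suc j)

ValidCF : (ℕ → ℕ) → Set
ValidCF cf = ∀ j → 1 ≤ cf (suc j)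

stdExp-cong : ∀ {cf cf′} → cf ≗⁺ cf′ → ∀ j → stdExp cf (suc j) ≡ stdExp cf′ (suc j)
stdExp-cong eq zero = cong (_∸ 1) (eq 0)
stdExp-cong eq (suc j) = eq (suc j)

stdSh-cong : ∀ {cf cf′} → cf ≗⁺ cf′ → ∀ m → stdSh cf m ≡ stdSh cf′ m
stdSh-cong eq zero = refl
stdSh-cong eq (suc zero) = refl
stdSh-cong eq (suc (suc m)) =
  cong₂ _++_ (cong₂ _^w_ (stdSh-cong eq (suc m)) (stdExp-cong eq m)) (stdSh-cong eq m)

charWord-cong : ∀ {cf cf′} → cf ≗⁺ cf′ → ∀ i → charWord cf i ≡ charWord cf′ i
charWord-cong eq i = cong (λ w → lookupD w i) (stdSh-cong eq (suc (suc i)))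

tailCF : (ℕ → ℕ) → (ℕ → ℕ)
tailCF cf zero = 0
tailCF cf (suc zero) = suc (cf 2)
tailCF cf (suc (suc j)) = cf (suc (suc (suc j)))

tailCF-valid : ∀ {cf} → ValidCF cf → ValidCF (tailCF cf)
tailCF-valid v zero = s≤s z≤n
tailCF-valid v (suc j) = v (suc (suc j))

stdSh-φ : ∀ cf m → stdSh cf (suc m) ≡ φ (cf 1 ∸ 1) (stdSh (tailCF cf) m)
stdSh-φ cf zero = refl
stdSh-φ cf (suc zero) = begin
  (a ∷ []) ^w (cf 1 ∸ 1) ++ b ∷ []          ≡⟨ cong (_++ b ∷ []) (a^w≡replicate (cf 1 ∸ 1)) ⟩
  replicate (cf 1 ∸ 1) a ++ b ∷ []          ≡⟨ ++-identityʳ _ ⟨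
  (replicate (cf 1 ∸ 1) a ++ b ∷ []) ++ []  ∎
  where open ≡-Reasoning
stdSh-φ cf (suc (suc m)) = begin
  stdSh cf (2 + m) ^w stdExp cf (2 + m) ++ stdSh cf (suc m)
    ≡⟨ cong₂ _++_ (cong₂ _^w_ (stdSh-φ cf (suc m)) (exponent m)) (stdSh-φ cf m) ⟩
  φ e (stdSh tcf (suc m)) ^w stdExp tcf (suc m) ++ φ e (stdSh tcf m)
    ≡⟨ cong (_++ φ e (stdSh tcf m)) (φ-^w e (stdSh tcf (suc m)) (stdExp tcf (suc m))) ⟨
  φ e (stdSh tcf (suc m) ^w stdExp tcf (suc m)) ++ φ e (stdSh tcf m)
    ≡⟨ φ-++ e (stdSh tcf (suc m) ^w stdExp tcf (suc m)) (stdSh tcf m) ⟨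
  φ e (stdSh tcf (suc m) ^w stdExp tcf (suc m) ++ stdSh tcf m) ∎
  where
  open ≡-Reasoning
  e = cf 1 ∸ 1
  tcf = tailCF cf
  exponent : ∀ m → stdExp cf (2 + m) ≡ stdExp tcf (suc m)
  exponent zero = refl
  exponent (suc m) = refl

stdSh-nonempty : ∀ cf m → 1 ≤ length (stdSh cf m)
stdSh-nonempty cf zero = s≤s z≤n
stdSh-nonempty cf (suc zero) = s≤s z≤n
stdSh-nonempty cf (suc (suc m)) =
  ≤-trans (stdSh-nonempty cf m) (≤-trans (m≤n+m _ _) (≤-reflexive (sym (length-++ (stdSh cf (suc m) ^w stdExp cf (suc m))))))

length-stdSh : ∀ {cf} → ValidCF cf → ∀ m → suc m ≤ length (stdSh cf (2 + m))
length-stdSh {cf} v zero = ≤-trans (m≤n+m 1 _) (≤-reflexive (sym (length-++ ((a ∷ []) ^w (cf 1 ∸ 1)))))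
length-stdSh {cf} v (suc m) with cf (2 + m) | v (suc m)
... | suc c | _ = begin
  suc (suc m)                            ≡⟨ +-comm 1 (suc m) ⟩
  suc m + 1                              ≤⟨ +-mono-≤ (length-stdSh v m) (stdSh-nonempty cf (suc m)) ⟩
  length X + length Y                    ≤⟨ +-monoˡ-≤ (length Y) (m≤m+n (length X) _) ⟩
  length X + length (X ^w c) + length Y  ≡⟨ cong (_+ length Y) (length-++ X) ⟨
  length (X ++ X ^w c) + length Y        ≡⟨ length-++ (X ++ X ^w c) ⟨
  length ((X ++ X ^w c) ++ Y)            ∎
  where
  open ≤-Reasoning
  X = stdSh cf (2 + m)
  Y = stdSh cf (suc m)

Prefix : Word → Word → Set
Prefix u w = Σ Word λ r → u ++ r ≡ w

prefix-trans : ∀ {u v w} → Prefix u v → Prefix v w → Prefix u w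
prefix-trans {u} (r , refl) (r′ , refl) = r ++ r′ , sym (++-assoc u r r′)

stdSh-prefix-suc : ∀ {cf} → ValidCF cf → ∀ m → Prefix (stdSh cf (2 + m)) (stdSh cf (3 + m))
stdSh-prefix-suc {cf} v m with cf (2 + m) | v (suc m)
... | suc c | _ = X ^w c ++ stdSh cf (suc m) , sym (++-assoc X (X ^w c) _)
  where X = stdSh cf (2 + m)

stdSh-prefix : ∀ {cf} → ValidCF cf → ∀ m k → Prefix (stdSh cf (2 + m)) (stdSh cf (2 + (k + m)))
stdSh-prefix v m zero = [] , ++-identityʳ _
stdSh-prefix v m (suc k) = prefix-trans (stdSh-prefix v m k) (stdSh-prefix-suc v (k + m))

lookupD-++ˡ : ∀ u r i → i < length u → lookupD (u ++ r) i ≡ lookupD u i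
lookupD-++ˡ (l ∷ u) r zero _ = refl
lookupD-++ˡ (l ∷ u) r (suc i) (s≤s i<u) = lookupD-++ˡ u r i i<u

charWord-prefix : ∀ {cf} → ValidCF cf → ∀ M → OccursAt (charWord cf) (stdSh cf (2 + M)) 0
charWord-prefix {cf} v M = lookup⇒occursAt (stdSh cf (2 + M)) letter
  where
  letter : ∀ j → j < length (stdSh cf (2 + M)) → charWord cf j ≡ lookupD (stdSh cf (2 + M)) j
  letter j j<M with ≤-total j M
  ... | inj₁ j≤M with stdSh-prefix v j (M ∸ j)
  ...   | r , eq rewrite m∸n+n≡m j≤M =
          trans (sym (lookupD-++ˡ (stdSh cf (2 + j)) r j (length-stdSh v j))) (cong (λ w → lookupD w j) eq)
  letter j j<M | inj₂ M≤j with stdSh-prefix v M (j ∸ M)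
  ...   | r , eq rewrite m∸n+n≡m M≤j =
          sym (trans (sym (lookupD-++ˡ (stdSh cf (2 + M)) r j j<M)) (cong (λ w → lookupD w j) eq))

blockLength : ℕ → Letter → ℕ
blockLength e l = length (φ₁ e l)

blockLength-a : ∀ e → blockLength e a ≡ suc e
blockLength-a e = trans (length-++ (replicate e a)) (trans (cong (_+ 1) (length-replicate e)) (+-comm e 1))

blockLength-pos : ∀ e l → 1 ≤ blockLength e l
blockLength-pos e a = ≤-trans (s≤s z≤n) (≤-reflexive (sym (blockLength-a e)))
blockLength-pos e b = s≤s z≤n

blockStart : ℕ → InfWord → ℕ → ℕ
blockStart e y zero = 0
blockStart e y (suc p) = blockStart e y p + blockLength e (y p)

blockStart-suc-a : ∀ {e y} p → y p ≡ a → blockStart e y (suc p) ≡ blockStart e y p + suc e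
blockStart-suc-a {e} {y} p yp = cong (blockStart e y p +_) (trans (cong (blockLength e) yp) (blockLength-a e))

blockStart-suc-b : ∀ {e y} p → y p ≡ b → blockStart e y (suc p) ≡ suc (blockStart e y p)
blockStart-suc-b {e} {y} p yp = trans (cong (λ l → blockStart e y p + blockLength e l) yp) (+-comm _ 1)

blockStart-+ : ∀ e y p g → blockStart e y (p + g) ≡ blockStart e y p + length (φ e (factor y p g))
blockStart-+ e y p zero = trans (cong (blockStart e y) (+-identityʳ p)) (sym (+-identityʳ _))
blockStart-+ e y p (suc g) = begin
  blockStart e y (p + suc g)                                             ≡⟨ cong (blockStart e y) (+-suc p g) ⟩
  blockStart e y (suc p + g)                                             ≡⟨ blockStart-+ e y (suc p) g ⟩
  blockStart e y p + blockLength e (y p) + length (φ e (factor y (suc p) g))  ≡⟨ +-assoc (blockStart e y p) _ _ ⟩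
  blockStart e y p + (length (φ₁ e (y p)) + length (φ e (factor y (suc p) g)))
    ≡⟨ cong (blockStart e y p +_) (length-++ (φ₁ e (y p))) ⟨
  blockStart e y p + length (φ e (factor y p (suc g)))                   ∎
  where open ≡-Reasoning

blockStart-occursAt : ∀ e {y : InfWord} w {p} → OccursAt y w p →
                      blockStart e y (p + length w) ≡ blockStart e y p + length (φ e w)
blockStart-occursAt e {y} w {p} h =
  trans (blockStart-+ e y p (length w)) (cong (λ v → blockStart e y p + length (φ e v)) (occursAt⇒factor w h))

blockOf : ∀ e y t → Σ ℕ λ p → Σ ℕ λ o → t ≡ blockStart e y p + o × o < blockLength e (y p)
blockOf e y zero = 0 , 0 , refl , blockLength-pos e (y 0)
blockOf e y (suc t) with blockOf e y t
... | p , o , t≡ , o< with suc o <? blockLength e (y p)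
...   | yes o+1< = p , suc o , trans (cong suc t≡) (sym (+-suc _ o)) , o+1<
...   | no o+1≮ = suc p , 0 , eq , blockLength-pos e (y (suc p))
  where
  eq : suc t ≡ blockStart e y (suc p) + 0
  eq = begin
    suc t                                  ≡⟨ cong suc t≡ ⟩
    suc (blockStart e y p + o)             ≡⟨ +-suc _ o ⟨
    blockStart e y p + suc o               ≡⟨ cong (blockStart e y p +_) (≤-antisym o< (≮⇒≥ o+1≮)) ⟩
    blockStart e y (suc p)                 ≡⟨ +-identityʳ _ ⟨
    blockStart e y (suc p) + 0             ∎
    where open ≡-Reasoning

blockOffset : ∀ e y t → Σ ℕ λ p → Σ ℕ λ o → t ≡ blockStart e y p + o × ((y p ≡ a × o ≤ e) ⊎ (y p ≡ b × o ≡ 0))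
blockOffset e y t with blockOf e y t
... | p , o , t≡ , o< = p , o , t≡ , byLetter (y p) refl o<
  where
  byLetter : ∀ l → y p ≡ l → o < blockLength e (y p) → (y p ≡ a × o ≤ e) ⊎ (y p ≡ b × o ≡ 0)
  byLetter a yp o< = inj₁ (yp , ≤-pred (≤-trans o< (≤-reflexive (trans (cong (blockLength e) yp) (blockLength-a e)))))
  byLetter b yp o< with ≤-trans o< (≤-reflexive (cong (blockLength e) yp))
  ... | s≤s z≤n = inj₂ (yp , refl)

record IsImage (e : ℕ) (y x : InfWord) : Set where
  field block : ∀ p → OccursAt x (φ₁ e (y p)) (blockStart e y p)
open IsImage

NoBB : InfWord → Set
NoBB y = ∀ p → y p ≡ b → y (suc p) ≡ a

IsImage-cong : ∀ {e y y′ x x′} → (∀ i → y i ≡ y′ i) → (∀ i → x i ≡ x′ i) → IsImage e y x → IsImage e y′ x′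
IsImage-cong {e} {y} {y′} {x} {x′} y≗y′ x≗x′ im = record { block = block′ }
  where
  starts : ∀ p → blockStart e y p ≡ blockStart e y′ p
  starts zero = refl
  starts (suc p) = cong₂ _+_ (starts p) (cong (blockLength e) (y≗y′ p))
  block′ : ∀ p → OccursAt x′ (φ₁ e (y′ p)) (blockStart e y′ p)
  block′ p = subst₂ (λ l t → OccursAt x′ (φ₁ e l) t) (y≗y′ p) (starts p) (occursAt-cong (φ₁ e (y p)) x≗x′ (block im p))

module _ {e y x} (im : IsImage e y x) where

  private
    blockᵃ : ∀ p → y p ≡ a → OccursAt x (replicate e a ++ b ∷ []) (blockStart e y p)
    blockᵃ p yp = subst (λ l → OccursAt x (φ₁ e l) (blockStart e y p)) yp (block im p)

  image-a : ∀ p → y p ≡ a → ∀ o → o < e → x (blockStart e y p + o) ≡ a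
  image-a p yp = occursAt-replicate⁻ e a (proj₁ (occursAt-++⁻ (replicate e a) (b ∷ []) (blockᵃ p yp)))

  image-b : ∀ p → y p ≡ a → x (blockStart e y p + e) ≡ b
  image-b p yp =
    trans (cong (λ o → x (blockStart e y p + o)) (sym (length-replicate e)))
          (proj₁ (occursAt-∷⁻ {x} [] (proj₂ (occursAt-++⁻ (replicate e a) (b ∷ []) (blockᵃ p yp)))))

  image-a-at-b : ∀ p → y p ≡ b → x (blockStart e y p) ≡ a
  image-a-at-b p yp = proj₁ (occursAt-∷⁻ {x} [] (subst (λ l → OccursAt x (φ₁ e l) (blockStart e y p)) yp (block im p)))

  image-occursAt : ∀ w p → OccursAt y w p → OccursAt x (φ e w) (blockStart e y p)
  image-occursAt [] p h = refl
  image-occursAt (l ∷ w) p h with occursAt-∷⁻ {y} w h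
  ... | refl , h′ = occursAt-++⁺ (φ₁ e (y p)) (φ e w) (block im p) (image-occursAt w (suc p) h′)

  image-factor : ∀ p g → factor x (blockStart e y p) (length (φ e (factor y p g))) ≡ φ e (factor y p g)
  image-factor p g = occursAt⇒factor (φ e (factor y p g)) (image-occursAt (factor y p g) p (factor-occursAt y p g))

  image-b-position : ∀ t → x t ≡ b → Σ ℕ λ p → y p ≡ a × t ≡ blockStart e y p + e
  image-b-position t xt with blockOf e y t
  ... | p , o , refl , o< with y p in yp
  ...   | b with o<
  ...     | s≤s z≤n = ⊥-elim (a≢b (trans (sym (trans (cong x (+-identityʳ _)) (image-a-at-b p yp))) xt))
  image-b-position t xt | p , o , refl , o< | a with o <? e
  ...     | yes o<e = ⊥-elim (a≢b (trans (sym (image-a p yp o o<e)) xt))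
  ...     | no o≮e =
    p , yp , cong (blockStart e y p +_) (≤-antisym (≤-pred (≤-trans o< (≤-reflexive (blockLength-a e)))) (≮⇒≥ o≮e))

  image-noBB : 1 ≤ e → NoBB x
  image-noBB e≥1 t xt with image-b-position t xt
  ... | p , yp , refl = trans (cong x next) (letterAfter (y (suc p)) refl)
    where
    next : suc (blockStart e y p + e) ≡ blockStart e y (suc p)
    next = trans (sym (+-suc _ e)) (sym (blockStart-suc-a p yp))
    letterAfter : ∀ l → y (suc p) ≡ l → x (blockStart e y (suc p)) ≡ a
    letterAfter a yp′ = trans (cong x (sym (+-identityʳ _))) (image-a (suc p) yp′ 0 e≥1)
    letterAfter b yp′ = image-a-at-b (suc p) yp′

  image-aᵉ-at-blockStart : NoBB y → ∀ p → OccursAt x (replicate e a) (blockStart e y p)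
  image-aᵉ-at-blockStart noBB p = occursAt-replicate⁺ e a letter
    where
    letter : ∀ j → j < e → x (blockStart e y p + j) ≡ a
    letter j j<e with y p in yp
    ... | a = image-a p yp j j<e
    ... | b with j
    ...   | zero = trans (cong x (+-identityʳ _)) (image-a-at-b p yp)
    ...   | suc j′ = trans (cong x shift) (image-a (suc p) (noBB p yp) j′ (<-trans (n<1+n j′) j<e))
      where
      shift : blockStart e y p + suc j′ ≡ blockStart e y (suc p) + j′
      shift = trans (+-suc _ j′) (cong (_+ j′) (sym (blockStart-suc-b p yp)))

isImage-fromPrefixes : ∀ {e y x} → (∀ M → Σ Word λ w → OccursAt y w 0 × M < length w × OccursAt x (φ e w) 0) →
                       IsImage e y x
isImage-fromPrefixes {e} {y} {x} prefixes = record { block = block′ }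
  where
  block′ : ∀ p → OccursAt x (φ₁ e (y p)) (blockStart e y p)
  block′ p with prefixes p
  ... | w , yw , p<w , xφw with m≤n⇒∃[o]m+o≡n p<w
  ... | k , p+1+k≡w =
    subst (OccursAt x (φ₁ e (y p))) (sym (blockStart-+ e y 0 p))
          (proj₁ (occursAt-++⁻ (φ₁ e (y p)) (φ e rest) (proj₂ (occursAt-++⁻ (φ e (factor y 0 p)) _ xφ′))))
    where
    rest = factor y (suc p) k
    w≡ : w ≡ factor y 0 p ++ y p ∷ rest
    w≡ = begin
      w                                ≡⟨ occursAt⇒factor w yw ⟨
      factor y 0 (length w)            ≡⟨ cong (factor y 0) (trans (sym p+1+k≡w) (sym (+-suc p k))) ⟩
      factor y 0 (p + suc k)           ≡⟨ factor-+ y 0 p (suc k) ⟩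
      factor y 0 p ++ y p ∷ rest       ∎
      where open ≡-Reasoning
    xφ′ : OccursAt x (φ e (factor y 0 p) ++ φ₁ e (y p) ++ φ e rest) 0
    xφ′ = subst (λ v → OccursAt x v 0) (trans (cong (φ e) w≡) (φ-++ e (factor y 0 p) _)) xφw

charWord-isImage : ∀ {cf} → ValidCF cf → IsImage (cf 1 ∸ 1) (charWord (tailCF cf)) (charWord cf)
charWord-isImage {cf} v = isImage-fromPrefixes λ M →
  stdSh (tailCF cf) (2 + M) , charWord-prefix (tailCF-valid v) M , length-stdSh (tailCF-valid v) M ,
  subst (λ w → OccursAt (charWord cf) w 0) (stdSh-φ cf (2 + M)) (charWord-prefix {cf} v (suc M))

module _ {e y x} (e≥1 : 1 ≤ e) (im : IsImage e y x) where

  private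
    e∸1<e : e ∸ 1 < e
    e∸1<e = ≤-reflexive (m+[n∸m]≡n e≥1)

    offset-e : ∀ t → t + e ≡ suc t + (e ∸ 1)
    offset-e t = trans (cong (t +_) (sym (m+[n∸m]≡n e≥1))) (+-suc t (e ∸ 1))

  aᵉ-occursAt⇒blockStart : ∀ t → OccursAt x (replicate e a) t → Σ ℕ λ p → t ≡ blockStart e y p
  aᵉ-occursAt⇒blockStart t h with blockOf e y t
  ... | p , zero , refl , _ = p , +-identityʳ _
  ... | p , suc o , refl , o< with y p in yp
  ...   | b with o<
  ...     | s≤s ()
  aᵉ-occursAt⇒blockStart t h | p , suc o , refl , o< | a =
    ⊥-elim (a≢b (trans (sym (trans (cong x (sym inside)) xa)) (image-b im p yp)))
    where
    o<e : suc o ≤ e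
    o<e = ≤-pred (≤-trans o< (≤-reflexive (blockLength-a e)))
    xa : x (blockStart e y p + suc o + (e ∸ suc o)) ≡ a
    xa = occursAt-replicate⁻ e a h (e ∸ suc o) (∸-monoʳ-< z<s o<e)
    inside : blockStart e y p + suc o + (e ∸ suc o) ≡ blockStart e y p + e
    inside = trans (+-assoc _ (suc o) _) (cong (blockStart e y p +_) (m+[n∸m]≡n o<e))

  desubstitute-at-blockStart : NoBB y → ∀ u p → OccursAt x (φ e u ++ replicate e a) (blockStart e y p) → OccursAt y u p
  desubstitute-at-blockStart noBB [] p h = refl
  desubstitute-at-blockStart noBB (a ∷ u) p h = byLetter (y p) refl
    where
    h′ = subst (λ w → OccursAt x w (blockStart e y p)) (++-assoc (φ₁ e a) (φ e u) _) h
    hφa = proj₁ (occursAt-++⁻ (φ₁ e a) (φ e u ++ replicate e a) h′)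
    hrest = proj₂ (occursAt-++⁻ (φ₁ e a) (φ e u ++ replicate e a) h′)
    byLetter : ∀ l → y p ≡ l → OccursAt y (a ∷ u) p
    byLetter a yp = occursAt-∷⁺ u yp (desubstitute-at-blockStart noBB u (suc p)
      (subst (OccursAt x (φ e u ++ replicate e a)) (cong (λ l → blockStart e y p + blockLength e l) (sym yp)) hrest))
    byLetter b yp = ⊥-elim (a≢b (trans (sym xa) xb))
      where
      xb : x (blockStart e y p + e) ≡ b
      xb = trans (cong (λ o → x (blockStart e y p + o)) (sym (length-replicate e)))
                 (proj₁ (occursAt-∷⁻ {x} [] (proj₂ (occursAt-++⁻ (replicate e a) (b ∷ []) hφa))))
      xa : x (blockStart e y p + e) ≡ a
      xa = trans (cong x (trans (offset-e _) (cong (_+ (e ∸ 1)) (sym (blockStart-suc-b p yp)))))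
                 (image-a im (suc p) (noBB p yp) (e ∸ 1) e∸1<e)
  desubstitute-at-blockStart noBB (b ∷ u) p h = byLetter (y p) refl
    where
    hrest = proj₂ (occursAt-∷⁻ (φ e u ++ replicate e a) h)
    byLetter : ∀ l → y p ≡ l → OccursAt y (b ∷ u) p
    byLetter b yp = occursAt-∷⁺ u yp (desubstitute-at-blockStart noBB u (suc p)
      (subst (OccursAt x (φ e u ++ replicate e a)) (sym (blockStart-suc-b p yp)) hrest))
    byLetter a yp = ⊥-elim (a≢b (trans (sym xa) (image-b im p yp)))
      where
      aᵉ-next : OccursAt x (replicate e a) (suc (blockStart e y p))
      aᵉ-next with φ-aᵉ-prefix e u
      ... | r , eq = proj₁ (occursAt-++⁻ (replicate e a) r (subst (λ w → OccursAt x w (suc (blockStart e y p))) eq hrest))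
      xa : x (blockStart e y p + e) ≡ a
      xa = trans (cong x (offset-e _)) (occursAt-replicate⁻ e a aᵉ-next (e ∸ 1) e∸1<e)

  desubstitute : NoBB y → ∀ u t → OccursAt x (φ e u ++ replicate e a) t →
                 Σ ℕ λ p → t ≡ blockStart e y p × OccursAt y u p
  desubstitute noBB u t h with φ-aᵉ-prefix e u
  ... | r , eq with aᵉ-occursAt⇒blockStart t (proj₁ (occursAt-++⁻ (replicate e a) r (subst (λ w → OccursAt x w t) eq h)))
  ... | p , refl = p , refl , desubstitute-at-blockStart noBB u p h

substitute : ∀ {e y x} → IsImage e y x → NoBB y → ∀ u p → OccursAt y u p →
             OccursAt x (φ e u ++ replicate e a) (blockStart e y p)
substitute {e} {y} im noBB u p h =
  occursAt-++⁺ (φ e u) (replicate e a) (image-occursAt im u p h)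
    (subst (OccursAt _ (replicate e a)) (blockStart-occursAt e u h) (image-aᵉ-at-blockStart im noBB (p + length u)))

Extendable : Word → ℕ → ℕ → Set
Extendable u r e =
  r ≡ 0 ⊎ ((Σ ℕ λ j → Σ Word λ z → u ≡ replicate j a ++ b ∷ z × j + r ≤ e)
         × (Σ ℕ λ j → Σ Word λ z → u ≡ z ++ b ∷ replicate j a × j + r ≤ e))

module _ {e y x} (im : IsImage e y x) where

  extend-left : ∀ j z r t → OccursAt x (replicate j a ++ b ∷ z) t → j + r ≤ e →
                r ≤ t × OccursAt x (replicate r a) (t ∸ r)
  extend-left j z r t h j+r≤e with m≤n⇒∃[o]m+o≡n j+r≤e
  ... | s , j+r+s≡e with image-b-position im (t + j) xb
    where
    xb : x (t + j) ≡ b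
    xb = trans (cong (λ k → x (t + k)) (sym (length-replicate j))) (occursAt⇒letter (replicate j a) z h)
  ... | p , yp , t+j≡ = r≤t , occursAt-replicate⁺ r a letter
    where
    B = blockStart e y p
    t≡ : t ≡ B + s + r
    t≡ = +-cancelʳ-≡ j t _ (trans t+j≡ (trans (cong (B +_) (sym j+r+s≡e)) (rearrange B j r s)))
      where
      rearrange : ∀ B j r s → B + (j + r + s) ≡ B + s + r + j
      rearrange = solve-∀
    r≤t : r ≤ t
    r≤t = ≤-trans (m≤n+m r (B + s)) (≤-reflexive (sym t≡))
    s+r≤e : s + r ≤ e
    s+r≤e = ≤-trans (≤-reflexive (+-comm s r)) (≤-trans (m≤n+m (r + s) j) (≤-reflexive (trans (sym (+-assoc j r s)) j+r+s≡e)))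
    letter : ∀ i → i < r → x (t ∸ r + i) ≡ a
    letter i i<r = trans (cong (λ k → x (k + i)) (trans (cong (_∸ r) t≡) (m+n∸n≡m (B + s) r)))
                         (trans (cong x (+-assoc B s i)) (image-a im p yp (s + i) (≤-trans (+-monoʳ-< s i<r) s+r≤e)))

  extend-right : NoBB y → ∀ z j r t → OccursAt x (z ++ b ∷ replicate j a) t → j + r ≤ e →
                 OccursAt x (replicate r a) (t + length (z ++ b ∷ replicate j a))
  extend-right noBB z j r t h j+r≤e with image-b-position im (t + length z) (occursAt⇒letter z (replicate j a) h)
  ... | p , yp , t+z≡ = occursAt-replicate⁺ r a letter
    where
    next : blockStart e y (suc p) ≡ suc (t + length z)
    next = trans (blockStart-suc-a p yp) (trans (+-suc _ e) (cong suc (sym t+z≡)))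
    letter : ∀ i → i < r → x (t + length (z ++ b ∷ replicate j a) + i) ≡ a
    letter i i<r = trans (cong x position)
      (occursAt-replicate⁻ e a (image-aᵉ-at-blockStart im noBB (suc p)) (j + i) (≤-trans (+-monoʳ-< j i<r) j+r≤e))
      where
      rearrange : ∀ t z j i → t + (z + suc j) + i ≡ suc (t + z) + (j + i)
      rearrange = solve-∀
      position : t + length (z ++ b ∷ replicate j a) + i ≡ blockStart e y (suc p) + (j + i)
      position = begin
        t + length (z ++ b ∷ replicate j a) + i   ≡⟨ cong (λ k → t + k + i) (length-++ z) ⟩
        t + (length z + suc (length (replicate j a))) + i ≡⟨ cong (λ k → t + (length z + suc k) + i) (length-replicate j) ⟩
        t + (length z + suc j) + i                ≡⟨ rearrange t (length z) j i ⟩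
        suc (t + length z) + (j + i)              ≡⟨ cong (_+ (j + i)) next ⟨
        blockStart e y (suc p) + (j + i)          ∎
        where open ≡-Reasoning

  extend : NoBB y → ∀ u r → Extendable u r e → ∀ t → OccursAt x u t →
           r ≤ t × OccursAt x (replicate r a ++ u ++ replicate r a) (t ∸ r)
  extend noBB u r (inj₁ refl) t h = z≤n , subst (λ w → OccursAt x w t) (sym (++-identityʳ u)) h
  extend noBB u r (inj₂ ((j , z , u≡ , j+r≤e) , (j′ , z′ , u≡′ , j′+r≤e))) t h
    with extend-left j z r t (subst (λ w → OccursAt x w t) u≡ h) j+r≤e
  ... | r≤t , left = r≤t , occursAt-++⁺ (replicate r a) (u ++ replicate r a) left
        (subst (OccursAt x (u ++ replicate r a)) (sym back) (occursAt-++⁺ u (replicate r a) h right))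
    where
    back : t ∸ r + length (replicate r a) ≡ t
    back = trans (cong (t ∸ r +_) (length-replicate r)) (m∸n+n≡m r≤t)
    right : OccursAt x (replicate r a) (t + length u)
    right = subst (λ w → OccursAt x (replicate r a) (t + length w)) (sym u≡′)
              (extend-right noBB z′ j′ r t (subst (λ w → OccursAt x w t) u≡′ h) j′+r≤e)

-- Occurrence patterns and their lifting through φₑ

subst2-zipWith : ∀ (f : ℕ → ℕ → ℕ) c x y x′ y′ i → subst2 c (f x x′) (f y y′) i ≡ f (subst2 c x y i) (subst2 c x′ y′ i)
subst2-zipWith f c x y x′ y′ i with c i
... | a = refl
... | b = refl

subst2-a : ∀ (c : InfWord) x y {i} → c i ≡ a → subst2 c x y i ≡ x
subst2-a c x y {i} ci with c i
subst2-a c x y refl | a = refl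

subst2-b : ∀ (c : InfWord) x y {i} → c i ≡ b → subst2 c x y i ≡ y
subst2-b c x y {i} ci with c i
subst2-b c x y refl | b = refl

subst2-≥ : ∀ (G : InfWord) {c x y} i → c ≤ x → c ≤ y → c ≤ subst2 G x y i
subst2-≥ G i c≤x c≤y with G i
... | a = c≤x
... | b = c≤y

gapSeq : InfWord → (Word → ℕ) → Word → Word → ℕ → ℕ → ℕ
gapSeq G f X Y m = subst2 G (f X) (m * f X + f Y)

positions : ℕ → (ℕ → ℕ) → ℕ → ℕ
positions p₀ g zero = p₀
positions p₀ g (suc i) = positions p₀ g i + g i

module _ (p₀ : ℕ) (g : ℕ → ℕ) (g≥1 : ∀ i → 1 ≤ g i) where

  positions-+ : ∀ i k → positions p₀ g i + k ≤ positions p₀ g (i + k)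
  positions-+ i zero = ≤-reflexive (trans (+-identityʳ _) (cong (positions p₀ g) (sym (+-identityʳ i))))
  positions-+ i (suc k) = begin
    positions p₀ g i + suc k        ≡⟨ +-suc _ k ⟩
    suc (positions p₀ g i + k)      ≤⟨ s≤s (positions-+ i k) ⟩
    suc (positions p₀ g (i + k))    ≡⟨ +-comm 1 _ ⟩
    positions p₀ g (i + k) + 1      ≤⟨ +-monoʳ-≤ (positions p₀ g (i + k)) (g≥1 (i + k)) ⟩
    positions p₀ g (suc (i + k))    ≡⟨ cong (positions p₀ g) (+-suc i k) ⟨
    positions p₀ g (i + suc k)      ∎
    where open ≤-Reasoning

  positions-monoʳ-≤ : ∀ {i j} → i ≤ j → positions p₀ g i ≤ positions p₀ g j
  positions-monoʳ-≤ {i} i≤j with m≤n⇒∃[o]m+o≡n i≤j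
  ... | k , refl = ≤-trans (m≤m+n _ k) (positions-+ i k)

  positions-monoʳ-< : ∀ {i j} → i < j → positions p₀ g i < positions p₀ g j
  positions-monoʳ-< {i} i<j =
    ≤-trans (≤-trans (≤-reflexive (+-comm 1 _)) (+-monoʳ-≤ (positions p₀ g i) (g≥1 i))) (positions-monoʳ-≤ i<j)

positions-≥ : ∀ p₀ g i → p₀ ≤ positions p₀ g i
positions-≥ p₀ g zero = ≤-refl
positions-≥ p₀ g (suc i) = ≤-trans (positions-≥ p₀ g i) (m≤m+n _ _)

positions-+ˡ : ∀ p₀ c g i → positions (p₀ + c) g i ≡ positions p₀ g i + c
positions-+ˡ p₀ c g zero = refl
positions-+ˡ p₀ c g (suc i) = begin
  positions (p₀ + c) g i + g i      ≡⟨ cong (_+ g i) (positions-+ˡ p₀ c g i) ⟩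
  positions p₀ g i + c + g i        ≡⟨ rearrange (positions p₀ g i) c (g i) ⟩
  positions p₀ g i + g i + c        ∎
  where
  open ≡-Reasoning
  rearrange : ∀ p c g → p + c + g ≡ p + g + c
  rearrange = solve-∀

module _ (G : InfWord) (e : ℕ) (X Y : Word) (m : ℕ) (i : ℕ) where

  gapSeq-φ-length : gapSeq G length (φ e X) (φ e Y) m i ≡ gapSeq G length X Y m i + e * gapSeq G (∣_∣ a) X Y m i
  gapSeq-φ-length = begin
    gapSeq G length (φ e X) (φ e Y) m i
      ≡⟨ cong₂ (λ p q → subst2 G p (m * p + q) i) (length-φ e X) (length-φ e Y) ⟩
    subst2 G (length X + e * ∣ X ∣ a) (m * (length X + e * ∣ X ∣ a) + (length Y + e * ∣ Y ∣ a)) i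
      ≡⟨ cong (λ q → subst2 G (length X + e * ∣ X ∣ a) q i) (rearrange m (length X) (length Y) e (∣ X ∣ a) (∣ Y ∣ a)) ⟩
    subst2 G (length X + e * ∣ X ∣ a) (m * length X + length Y + e * (m * ∣ X ∣ a + ∣ Y ∣ a)) i
      ≡⟨ subst2-zipWith (λ g c → g + e * c) G _ _ _ _ i ⟩
    gapSeq G length X Y m i + e * gapSeq G (∣_∣ a) X Y m i ∎
    where
    open ≡-Reasoning
    rearrange : ∀ m lX lY e aX aY → m * (lX + e * aX) + (lY + e * aY) ≡ m * lX + lY + e * (m * aX + aY)
    rearrange = solve-∀

  gapSeq-φ-count-a : gapSeq G (∣_∣ a) (φ e X) (φ e Y) m i ≡ e * gapSeq G (∣_∣ a) X Y m i + gapSeq G (∣_∣ b) X Y m i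
  gapSeq-φ-count-a = begin
    gapSeq G (∣_∣ a) (φ e X) (φ e Y) m i
      ≡⟨ cong₂ (λ p q → subst2 G p (m * p + q) i) (count-a-φ e X) (count-a-φ e Y) ⟩
    subst2 G (e * ∣ X ∣ a + ∣ X ∣ b) (m * (e * ∣ X ∣ a + ∣ X ∣ b) + (e * ∣ Y ∣ a + ∣ Y ∣ b)) i
      ≡⟨ cong (λ q → subst2 G (e * ∣ X ∣ a + ∣ X ∣ b) q i) (rearrange m e (∣ X ∣ a) (∣ X ∣ b) (∣ Y ∣ a) (∣ Y ∣ b)) ⟩
    subst2 G (e * ∣ X ∣ a + ∣ X ∣ b) (e * (m * ∣ X ∣ a + ∣ Y ∣ a) + (m * ∣ X ∣ b + ∣ Y ∣ b)) i
      ≡⟨ subst2-zipWith (λ c c′ → e * c + c′) G _ _ _ _ i ⟩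
    e * gapSeq G (∣_∣ a) X Y m i + gapSeq G (∣_∣ b) X Y m i ∎
    where
    open ≡-Reasoning
    rearrange : ∀ m e aX bX aY bY → m * (e * aX + bX) + (e * aY + bY) ≡ e * (m * aX + aY) + (m * bX + bY)
    rearrange = solve-∀

  gapSeq-φ-count-b : gapSeq G (∣_∣ b) (φ e X) (φ e Y) m i ≡ gapSeq G (∣_∣ a) X Y m i
  gapSeq-φ-count-b = cong₂ (λ p q → subst2 G p (m * p + q) i) (count-b-φ e X) (count-b-φ e Y)

count-factor-shift : ∀ {x : InfWord} r t L l → OccursAt x (replicate r a) t → OccursAt x (replicate r a) (t + L) →
                     ∣ factor x (t + r) L ∣ l ≡ ∣ factor x t L ∣ l
count-factor-shift {x} r t L l aʳ-at-t aʳ-at-t+L = +-cancelˡ-≡ (∣ aʳ ∣ l) _ _ (begin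
  ∣ aʳ ∣ l + ∣ factor x (t + r) L ∣ l                  ≡⟨ cong (λ w → ∣ w ∣ l + ∣ factor x (t + r) L ∣ l) (factor-aʳ r aʳ-at-t) ⟨
  ∣ factor x t r ∣ l + ∣ factor x (t + r) L ∣ l        ≡⟨ count-++ (factor x t r) _ l ⟨
  ∣ factor x t r ++ factor x (t + r) L ∣ l             ≡⟨ cong (∣_∣ l) (factor-+ x t r L) ⟨
  ∣ factor x t (r + L) ∣ l                             ≡⟨ cong (λ k → ∣ factor x t k ∣ l) (+-comm r L) ⟩
  ∣ factor x t (L + r) ∣ l                             ≡⟨ cong (∣_∣ l) (factor-+ x t L r) ⟩
  ∣ factor x t L ++ factor x (t + L) r ∣ l             ≡⟨ count-++ (factor x t L) _ l ⟩
  ∣ factor x t L ∣ l + ∣ factor x (t + L) r ∣ l        ≡⟨ cong (λ w → ∣ factor x t L ∣ l + ∣ w ∣ l) (factor-aʳ r aʳ-at-t+L) ⟩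
  ∣ factor x t L ∣ l + ∣ aʳ ∣ l                        ≡⟨ +-comm _ (∣ aʳ ∣ l) ⟩
  ∣ aʳ ∣ l + ∣ factor x t L ∣ l                        ∎)
  where
  open ≡-Reasoning
  aʳ = replicate r a

length-φ-factor : ∀ e y p g → length (φ e (factor y p g)) ≡ g + e * ∣ factor y p g ∣ a
length-φ-factor e y p g = trans (length-φ e (factor y p g)) (cong (_+ e * ∣ factor y p g ∣ a) (length-factor y p g))

blockStart-+-count : ∀ e y p g → blockStart e y (p + g) ≡ blockStart e y p + (g + e * ∣ factor y p g ∣ a)
blockStart-+-count e y p g = trans (blockStart-+ e y p g) (cong (blockStart e y p +_) (length-φ-factor e y p g))

image-factor-count : ∀ {e y x} → IsImage e y x → ∀ p g l →
                     ∣ factor x (blockStart e y p) (g + e * ∣ factor y p g ∣ a) ∣ l ≡ ∣ φ e (factor y p g) ∣ l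
image-factor-count {e} {y} {x} im p g l =
  cong (∣_∣ l) (trans (cong (factor x (blockStart e y p)) (sym (length-φ-factor e y p g))) (image-factor im p g))

-- The centre identity 2|P| + |u| + 2 = (m+1)|X| + |Y| and the gap counts are kept letter by
-- letter, since φₑ rescales lengths through the number of a's.
record OccurrencePattern (x : InfWord) (u : Word) (G : InfWord) (P X Y : Word) (m : ℕ) : Set where
  field
    prefix       : OccursAt x P 0
    complete     : ∀ t → OccursAt x u t → Σ ℕ λ i → t ≡ positions (length P) (gapSeq G length X Y m) i
    sound        : ∀ i → OccursAt x u (positions (length P) (gapSeq G length X Y m) i)
    gap-count    : ∀ l i → ∣ factor x (positions (length P) (gapSeq G length X Y m) i) (gapSeq G length X Y m i) ∣ l
                           ≡ gapSeq G (∣_∣ l) X Y m i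
    centre-count : ∀ l → 2 * ∣ P ∣ l + ∣ u ∣ l + 1 ≡ suc m * ∣ X ∣ l + ∣ Y ∣ l
open OccurrencePattern

-- u′ lifts to u when aʳuaʳ = φₑ(u′)aᵉ and the aʳ removed on each side are forced around
-- every occurrence of u in an image.
Lift : ℕ → Word → Word → Set
Lift e u u′ = Σ ℕ λ r → (replicate r a ++ u ++ replicate r a ≡ φ e u′ ++ replicate e a) × Extendable u r e

module Lifting {e y x} (e≥1 : 1 ≤ e) (im : IsImage e y x) (noBB : NoBB y)
               {u′ G P′ X′ Y′ m} (pat : OccurrencePattern y u′ G P′ X′ Y′ m)
               (u : Word) (lift : Lift e u u′) where

  r = proj₁ lift
  aʳ = replicate r a
  aᵉ = replicate e a
  P = φ e P′ ++ aʳ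
  gy = gapSeq G length X′ Y′ m
  gx = gapSeq G length (φ e X′) (φ e Y′) m
  py = positions (length P′) gy
  px = positions (length P) gx
  F : ℕ → Word
  F i = factor y (py i) (gy i)

  aʳuaʳ≡ : aʳ ++ u ++ aʳ ≡ φ e u′ ++ aᵉ
  aʳuaʳ≡ = proj₁ (proj₂ lift)

  gx≡ : ∀ i → gx i ≡ gy i + e * ∣ F i ∣ a
  gx≡ i = trans (gapSeq-φ-length G e X′ Y′ m i) (cong (λ c → gy i + e * c) (sym (gap-count pat a i)))

  px≡ : ∀ i → px i ≡ blockStart e y (py i) + r
  px≡ zero = begin
    length (φ e P′ ++ aʳ)                      ≡⟨ length-++ (φ e P′) ⟩
    length (φ e P′) + length aʳ                ≡⟨ cong₂ _+_ (blockStart-occursAt e P′ (prefix pat)) (sym (length-replicate r)) ⟨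
    blockStart e y (length P′) + r             ∎
    where open ≡-Reasoning
  px≡ (suc i) = begin
    px i + gx i                                              ≡⟨ cong₂ _+_ (px≡ i) (gx≡ i) ⟩
    blockStart e y (py i) + r + (gy i + e * ∣ F i ∣ a)       ≡⟨ rearrange (blockStart e y (py i)) r _ ⟩
    blockStart e y (py i) + (gy i + e * ∣ F i ∣ a) + r       ≡⟨ cong (_+ r) (blockStart-+-count e y (py i) (gy i)) ⟨
    blockStart e y (py i + gy i) + r                         ∎
    where
    open ≡-Reasoning
    rearrange : ∀ B r g → B + r + g ≡ B + g + r
    rearrange = solve-∀

  aʳuaʳ-at : ∀ i → OccursAt x (aʳ ++ u ++ aʳ) (blockStart e y (py i))
  aʳuaʳ-at i = subst (λ w → OccursAt x w (blockStart e y (py i))) (sym aʳuaʳ≡) (substitute im noBB u′ (py i) (sound pat i))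

  aʳ-at : ∀ i → OccursAt x aʳ (blockStart e y (py i))
  aʳ-at i = proj₁ (occursAt-++⁻ aʳ (u ++ aʳ) (aʳuaʳ-at i))

  prefix′ : OccursAt x P 0
  prefix′ = occursAt-++⁺ (φ e P′) aʳ (image-occursAt im P′ 0 (prefix pat))
              (subst (OccursAt x aʳ) (blockStart-occursAt e P′ (prefix pat)) (aʳ-at 0))

  sound′ : ∀ i → OccursAt x u (px i)
  sound′ i = subst (OccursAt x u) (sym (px≡ i)) (occursAt-middle u r _ (aʳuaʳ-at i))

  complete′ : ∀ t → OccursAt x u t → Σ ℕ λ i → t ≡ px i
  complete′ t h with extend im noBB u r (proj₂ (proj₂ lift)) t h
  ... | r≤t , aʳuaʳ-at-t with desubstitute e≥1 im noBB u′ (t ∸ r) (subst (λ w → OccursAt x w (t ∸ r)) aʳuaʳ≡ aʳuaʳ-at-t)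
  ... | p , t∸r≡ , u′-at-p with complete pat p u′-at-p
  ... | i , refl = i , trans (sym (m∸n+n≡m r≤t)) (trans (cong (_+ r) t∸r≡) (sym (px≡ i)))

  gap-image-count : ∀ l i → ∣ factor x (px i) (gx i) ∣ l ≡ ∣ φ e (F i) ∣ l
  gap-image-count l i = begin
    ∣ factor x (px i) (gx i) ∣ l                                     ≡⟨ cong₂ (λ t g → ∣ factor x t g ∣ l) (px≡ i) (gx≡ i) ⟩
    ∣ factor x (blockStart e y (py i) + r) L ∣ l                     ≡⟨ count-factor-shift r _ L l (aʳ-at i) aʳ-at-end ⟩
    ∣ factor x (blockStart e y (py i)) L ∣ l                         ≡⟨ image-factor-count im (py i) (gy i) l ⟩
    ∣ φ e (F i) ∣ l                                                  ∎
    where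
    open ≡-Reasoning
    L = gy i + e * ∣ F i ∣ a
    aʳ-at-end : OccursAt x aʳ (blockStart e y (py i) + L)
    aʳ-at-end = subst (OccursAt x aʳ) (blockStart-+-count e y (py i) (gy i)) (aʳ-at (suc i))

  gap-count′ : ∀ l i → ∣ factor x (px i) (gx i) ∣ l ≡ gapSeq G (∣_∣ l) (φ e X′) (φ e Y′) m i
  gap-count′ a i = begin
    ∣ factor x (px i) (gx i) ∣ a                           ≡⟨ gap-image-count a i ⟩
    ∣ φ e (F i) ∣ a                                        ≡⟨ count-a-φ e (F i) ⟩
    e * ∣ F i ∣ a + ∣ F i ∣ b                              ≡⟨ cong₂ (λ p q → e * p + q) (gap-count pat a i) (gap-count pat b i) ⟩
    e * gapSeq G (∣_∣ a) X′ Y′ m i + gapSeq G (∣_∣ b) X′ Y′ m i ≡⟨ gapSeq-φ-count-a G e X′ Y′ m i ⟨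
    gapSeq G (∣_∣ a) (φ e X′) (φ e Y′) m i                 ∎
    where open ≡-Reasoning
  gap-count′ b i = begin
    ∣ factor x (px i) (gx i) ∣ b                           ≡⟨ gap-image-count b i ⟩
    ∣ φ e (F i) ∣ b                                        ≡⟨ count-b-φ e (F i) ⟩
    ∣ F i ∣ a                                              ≡⟨ gap-count pat a i ⟩
    gapSeq G (∣_∣ a) X′ Y′ m i                             ≡⟨ gapSeq-φ-count-b G e X′ Y′ m i ⟨
    gapSeq G (∣_∣ b) (φ e X′) (φ e Y′) m i                 ∎
    where open ≡-Reasoning

  count-aʳuaʳ : ∀ l → ∣ aʳ ∣ l + (∣ u ∣ l + ∣ aʳ ∣ l) ≡ ∣ φ e u′ ∣ l + ∣ aᵉ ∣ l
  count-aʳuaʳ l = begin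
    ∣ aʳ ∣ l + (∣ u ∣ l + ∣ aʳ ∣ l)     ≡⟨ cong (∣ aʳ ∣ l +_) (count-++ u aʳ l) ⟨
    ∣ aʳ ∣ l + ∣ u ++ aʳ ∣ l            ≡⟨ count-++ aʳ (u ++ aʳ) l ⟨
    ∣ aʳ ++ u ++ aʳ ∣ l                 ≡⟨ cong (∣_∣ l) aʳuaʳ≡ ⟩
    ∣ φ e u′ ++ aᵉ ∣ l                  ≡⟨ count-++ (φ e u′) aᵉ l ⟩
    ∣ φ e u′ ∣ l + ∣ aᵉ ∣ l             ∎
    where open ≡-Reasoning

  centre-count′ : ∀ l → 2 * ∣ P ∣ l + ∣ u ∣ l + 1 ≡ suc m * ∣ φ e X′ ∣ l + ∣ φ e Y′ ∣ l
  centre-count′ a = begin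
    2 * ∣ P ∣ a + ∣ u ∣ a + 1
      ≡⟨ cong (λ k → 2 * k + ∣ u ∣ a + 1) (trans (count-++ (φ e P′) aʳ a) (cong₂ _+_ (count-a-φ e P′) (count-aⁿ-a r))) ⟩
    2 * (e * ∣ P′ ∣ a + ∣ P′ ∣ b + r) + ∣ u ∣ a + 1
      ≡⟨ rearrange₁ e (∣ P′ ∣ a) (∣ P′ ∣ b) r (∣ u ∣ a) ⟩
    e * (2 * ∣ P′ ∣ a) + 2 * ∣ P′ ∣ b + (r + (∣ u ∣ a + r)) + 1
      ≡⟨ cong (λ k → e * (2 * ∣ P′ ∣ a) + 2 * ∣ P′ ∣ b + k + 1) u-count ⟩
    e * (2 * ∣ P′ ∣ a) + 2 * ∣ P′ ∣ b + (e * ∣ u′ ∣ a + ∣ u′ ∣ b + e) + 1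
      ≡⟨ rearrange₂ e (∣ P′ ∣ a) (∣ P′ ∣ b) (∣ u′ ∣ a) (∣ u′ ∣ b) ⟩
    e * (2 * ∣ P′ ∣ a + ∣ u′ ∣ a + 1) + (2 * ∣ P′ ∣ b + ∣ u′ ∣ b + 1)
      ≡⟨ cong₂ (λ p q → e * p + q) (centre-count pat a) (centre-count pat b) ⟩
    e * (suc m * ∣ X′ ∣ a + ∣ Y′ ∣ a) + (suc m * ∣ X′ ∣ b + ∣ Y′ ∣ b)
      ≡⟨ rearrange₃ e m (∣ X′ ∣ a) (∣ X′ ∣ b) (∣ Y′ ∣ a) (∣ Y′ ∣ b) ⟩
    suc m * (e * ∣ X′ ∣ a + ∣ X′ ∣ b) + (e * ∣ Y′ ∣ a + ∣ Y′ ∣ b)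
      ≡⟨ cong₂ (λ p q → suc m * p + q) (count-a-φ e X′) (count-a-φ e Y′) ⟨
    suc m * ∣ φ e X′ ∣ a + ∣ φ e Y′ ∣ a ∎
    where
    open ≡-Reasoning
    u-count : r + (∣ u ∣ a + r) ≡ e * ∣ u′ ∣ a + ∣ u′ ∣ b + e
    u-count = begin
      r + (∣ u ∣ a + r)                  ≡⟨ cong₂ (λ p q → p + (∣ u ∣ a + q)) (count-aⁿ-a r) (count-aⁿ-a r) ⟨
      ∣ aʳ ∣ a + (∣ u ∣ a + ∣ aʳ ∣ a)    ≡⟨ count-aʳuaʳ a ⟩
      ∣ φ e u′ ∣ a + ∣ aᵉ ∣ a            ≡⟨ cong₂ _+_ (count-a-φ e u′) (count-aⁿ-a e) ⟩
      e * ∣ u′ ∣ a + ∣ u′ ∣ b + e        ∎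
    rearrange₁ : ∀ e A B r U → 2 * (e * A + B + r) + U + 1 ≡ e * (2 * A) + 2 * B + (r + (U + r)) + 1
    rearrange₁ = solve-∀
    rearrange₂ : ∀ e A B A′ B′ → e * (2 * A) + 2 * B + (e * A′ + B′ + e) + 1 ≡ e * (2 * A + A′ + 1) + (2 * B + B′ + 1)
    rearrange₂ = solve-∀
    rearrange₃ : ∀ e m A B A′ B′ → e * (suc m * A + A′) + (suc m * B + B′) ≡ suc m * (e * A + B) + (e * A′ + B′)
    rearrange₃ = solve-∀
  centre-count′ b = begin
    2 * ∣ P ∣ b + ∣ u ∣ b + 1           ≡⟨ cong₂ (λ p q → 2 * p + q + 1) P-count u-count ⟩
    2 * ∣ P′ ∣ a + ∣ u′ ∣ a + 1         ≡⟨ centre-count pat a ⟩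
    suc m * ∣ X′ ∣ a + ∣ Y′ ∣ a         ≡⟨ cong₂ (λ p q → suc m * p + q) (count-b-φ e X′) (count-b-φ e Y′) ⟨
    suc m * ∣ φ e X′ ∣ b + ∣ φ e Y′ ∣ b ∎
    where
    open ≡-Reasoning
    P-count : ∣ P ∣ b ≡ ∣ P′ ∣ a
    P-count = trans (count-++ (φ e P′) aʳ b) (trans (cong₂ _+_ (count-b-φ e P′) (count-aⁿ-b r)) (+-identityʳ _))
    u-count : ∣ u ∣ b ≡ ∣ u′ ∣ a
    u-count = begin
      ∣ u ∣ b                            ≡⟨ +-identityʳ _ ⟨
      0 + (∣ u ∣ b + 0)                  ≡⟨ cong₂ (λ p q → p + (∣ u ∣ b + q)) (count-aⁿ-b r) (count-aⁿ-b r) ⟨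
      ∣ aʳ ∣ b + (∣ u ∣ b + ∣ aʳ ∣ b)    ≡⟨ count-aʳuaʳ b ⟩
      ∣ φ e u′ ∣ b + ∣ aᵉ ∣ b            ≡⟨ cong₂ _+_ (count-b-φ e u′) (count-aⁿ-b e) ⟩
      ∣ u′ ∣ a + 0                       ≡⟨ +-identityʳ _ ⟩
      ∣ u′ ∣ a                           ∎

  pattern′ : OccurrencePattern x u G P (φ e X′) (φ e Y′) m
  pattern′ = record
    { prefix = prefix′ ; complete = complete′ ; sound = sound′ ; gap-count = gap-count′ ; centre-count = centre-count′ }

-- In φₑ(y), aᵐ occurs at the first e − m + 1 positions of each block aᵉb and at each block a;
-- G = φ_{e−m}(y) lists them, a letter a of G giving gap 1 and a letter b the gap m + 1 over the b.
module PowerPattern {e y x G m} (im : IsImage e y x) (noBB : NoBB y) (imG : IsImage (e ∸ m) y G) (m≤e : m ≤ e) where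

  f = e ∸ m
  gap = gapSeq G length (a ∷ []) (b ∷ []) m
  pos = positions 0 gap
  Bx = blockStart e y
  BG = blockStart f y

  f+m≡e : f + m ≡ e
  f+m≡e = m∸n+n≡m m≤e

  gap-a : ∀ {i} → G i ≡ a → gap i ≡ 1
  gap-a = subst2-a G 1 (m * 1 + 1)

  gap-b : ∀ {i} → G i ≡ b → gap i ≡ m * 1 + 1
  gap-b = subst2-b G 1 (m * 1 + 1)

  pos-blockStart : ∀ p → pos (BG p) ≡ Bx p
  pos-inside : ∀ p o → o ≤ f → y p ≡ a → pos (BG p + o) ≡ Bx p + o
  pos-inside p zero _ _ = trans (cong pos (+-identityʳ (BG p))) (trans (pos-blockStart p) (sym (+-identityʳ (Bx p))))
  pos-inside p (suc o) o<f yp = begin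
    pos (BG p + suc o)                ≡⟨ cong pos (+-suc _ o) ⟩
    pos (BG p + o) + gap (BG p + o)   ≡⟨ cong₂ _+_ (pos-inside p o (≤-trans (n≤1+n o) o<f) yp) (gap-a (image-a imG p yp o o<f)) ⟩
    Bx p + o + 1                      ≡⟨ trans (+-assoc _ o 1) (cong (Bx p +_) (+-comm o 1)) ⟩
    Bx p + suc o                      ∎
    where open ≡-Reasoning
  pos-blockStart zero = refl
  pos-blockStart (suc p) = byLetter (y p) refl
    where
    byLetter : ∀ l → y p ≡ l → pos (BG (suc p)) ≡ Bx (suc p)
    byLetter a yp = begin
      pos (BG (suc p))                  ≡⟨ cong pos (trans (blockStart-suc-a p yp) (+-suc _ f)) ⟩
      pos (BG p + f) + gap (BG p + f)   ≡⟨ cong₂ _+_ (pos-inside p f ≤-refl yp) (gap-b (image-b imG p yp)) ⟩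
      Bx p + f + (m * 1 + 1)            ≡⟨ rearrange (Bx p) f m ⟩
      Bx p + suc (f + m)                ≡⟨ cong (λ k → Bx p + suc k) f+m≡e ⟩
      Bx p + suc e                      ≡⟨ blockStart-suc-a p yp ⟨
      Bx (suc p)                        ∎
      where
      open ≡-Reasoning
      rearrange : ∀ B f m → B + f + (m * 1 + 1) ≡ B + suc (f + m)
      rearrange = solve-∀
    byLetter b yp = begin
      pos (BG (suc p))                  ≡⟨ cong pos (blockStart-suc-b p yp) ⟩
      pos (BG p) + gap (BG p)           ≡⟨ cong₂ _+_ (pos-blockStart p) (gap-a (image-a-at-b imG p yp)) ⟩
      Bx p + 1                          ≡⟨ +-comm _ 1 ⟩
      suc (Bx p)                        ≡⟨ blockStart-suc-b p yp ⟨
      Bx (suc p)                        ∎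
      where open ≡-Reasoning

  aᵐ-inside : ∀ p o → o ≤ f → y p ≡ a → OccursAt x (replicate m a) (Bx p + o)
  aᵐ-inside p o o≤f yp = occursAt-replicate⁺ m a λ j j<m →
    trans (cong x (+-assoc (Bx p) o j))
          (image-a im p yp (o + j) (≤-trans (+-monoʳ-< o j<m) (≤-trans (+-monoˡ-≤ m o≤f) (≤-reflexive f+m≡e))))

  aᵐ-at-b : ∀ p → y p ≡ b → OccursAt x (replicate m a) (Bx p)
  aᵐ-at-b p yp = occursAt-replicate⁺ m a letter
    where
    letter : ∀ j → j < m → x (Bx p + j) ≡ a
    letter zero _ = trans (cong x (+-identityʳ _)) (image-a-at-b im p yp)
    letter (suc j) j<m = trans (cong x (trans (+-suc _ j) (cong (_+ j) (sym (blockStart-suc-b p yp)))))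
                               (image-a im (suc p) (noBB p yp) j (≤-trans (≤-trans (n≤1+n (suc j)) j<m) m≤e))

  sound′ : ∀ i → OccursAt x (replicate m a) (pos i)
  sound′ i with blockOffset f y i
  ... | p , o , refl , inj₁ (yp , o≤f) = subst (OccursAt x (replicate m a)) (sym (pos-inside p o o≤f yp)) (aᵐ-inside p o o≤f yp)
  ... | p , o , refl , inj₂ (yp , refl) =
    subst (OccursAt x (replicate m a)) (sym (trans (cong pos (+-identityʳ (BG p))) (pos-blockStart p))) (aᵐ-at-b p yp)

  complete′ : ∀ t → OccursAt x (replicate m a) t → Σ ℕ λ i → t ≡ pos i
  complete′ t h with blockOffset e y t
  ... | p , o , refl , inj₂ (yp , refl) = BG p , trans (+-identityʳ _) (sym (pos-blockStart p))
  ... | p , o , refl , inj₁ (yp , o≤e) with o ≤? f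
  ...   | yes o≤f = BG p + o , sym (pos-inside p o o≤f yp)
  ...   | no o≰f = ⊥-elim (a≢b (trans (sym (trans (cong x at-b) xa)) (image-b im p yp)))
    where
    e∸o<m : e ∸ o < m
    e∸o<m = +-cancelˡ-≤ o (suc (e ∸ o)) m
      (≤-trans (≤-reflexive e+1≡) (≤-trans (≤-reflexive (cong suc (sym f+m≡e))) (+-monoˡ-≤ m (≰⇒> o≰f))))
      where
      e+1≡ : o + suc (e ∸ o) ≡ suc e
      e+1≡ = trans (+-suc o _) (cong suc (m+[n∸m]≡n o≤e))
    xa : x (Bx p + o + (e ∸ o)) ≡ a
    xa = occursAt-replicate⁻ m a h (e ∸ o) e∸o<m
    at-b : Bx p + e ≡ Bx p + o + (e ∸ o)
    at-b = trans (cong (Bx p +_) (sym (m+[n∸m]≡n o≤e))) (sym (+-assoc (Bx p) o (e ∸ o)))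

  x-at-a : ∀ {i} → G i ≡ a → x (pos i) ≡ a
  x-at-a {i} Gi with blockOffset f y i
  ... | p , o , refl , inj₂ (yp , refl) =
    trans (cong x (trans (cong pos (+-identityʳ (BG p))) (pos-blockStart p))) (image-a-at-b im p yp)
  ... | p , o , refl , inj₁ (yp , o≤f) with o ≟ f
  ...   | yes refl = ⊥-elim (a≢b (trans (sym Gi) (image-b imG p yp)))
  ...   | no o≢f = trans (cong x (pos-inside p o o≤f yp)) (image-a im p yp o (≤-trans (≤∧≢⇒< o≤f o≢f) (m∸n≤m e m)))

  G-b-position : ∀ {i} → G i ≡ b → Σ ℕ λ p → y p ≡ a × pos i ≡ Bx p + f
  G-b-position {i} Gi with blockOffset f y i
  ... | p , o , refl , inj₂ (yp , refl) =
    ⊥-elim (a≢b (trans (sym (image-a-at-b imG p yp)) (trans (cong G (sym (+-identityʳ _))) Gi)))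
  ... | p , o , refl , inj₁ (yp , o≤f) with o ≟ f
  ...   | yes refl = p , yp , pos-inside p f ≤-refl yp
  ...   | no o≢f = ⊥-elim (a≢b (trans (sym (image-a imG p yp o (≤∧≢⇒< o≤f o≢f))) Gi))

  aᵐb-at : ∀ p → y p ≡ a → OccursAt x (replicate m a ++ b ∷ []) (Bx p + f)
  aᵐb-at p yp = occursAt-++⁺ (replicate m a) (b ∷ []) (aᵐ-inside p f ≤-refl yp)
    (occursAt-∷⁺ {x} [] (trans (cong x end) (image-b im p yp)) refl)
    where
    end : Bx p + f + length (replicate m a) ≡ Bx p + e
    end = trans (+-assoc (Bx p) f _) (cong (Bx p +_) (trans (cong (f +_) (length-replicate m)) f+m≡e))

  gap-count′ : ∀ l i → ∣ factor x (pos i) (gap i) ∣ l ≡ gapSeq G (∣_∣ l) (a ∷ []) (b ∷ []) m i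
  gap-count′ l i = byLetter (G i) refl
    where
    byLetter : ∀ l′ → G i ≡ l′ → ∣ factor x (pos i) (gap i) ∣ l ≡ gapSeq G (∣_∣ l) (a ∷ []) (b ∷ []) m i
    byLetter a Gi = begin
      ∣ factor x (pos i) (gap i) ∣ l   ≡⟨ cong (λ k → ∣ factor x (pos i) k ∣ l) (gap-a Gi) ⟩
      ∣ x (pos i) ∷ [] ∣ l             ≡⟨ cong (λ l′ → ∣ l′ ∷ [] ∣ l) (x-at-a Gi) ⟩
      ∣ a ∷ [] ∣ l                     ≡⟨ subst2-a G (∣ a ∷ [] ∣ l) (m * ∣ a ∷ [] ∣ l + ∣ b ∷ [] ∣ l) Gi ⟨
      gapSeq G (∣_∣ l) (a ∷ []) (b ∷ []) m i ∎
      where open ≡-Reasoning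
    byLetter b Gi with G-b-position Gi
    ... | p , yp , pos≡ = begin
      ∣ factor x (pos i) (gap i) ∣ l
        ≡⟨ cong₂ (λ t k → ∣ factor x t k ∣ l) pos≡ (trans (gap-b Gi) (sym length-aᵐb)) ⟩
      ∣ factor x (Bx p + f) (length (replicate m a ++ b ∷ [])) ∣ l
        ≡⟨ cong (∣_∣ l) (occursAt⇒factor (replicate m a ++ b ∷ []) (aᵐb-at p yp)) ⟩
      ∣ replicate m a ++ b ∷ [] ∣ l                                 ≡⟨ count-++ (replicate m a) (b ∷ []) l ⟩
      ∣ replicate m a ∣ l + ∣ b ∷ [] ∣ l                            ≡⟨ cong (_+ ∣ b ∷ [] ∣ l) (count-replicate m a l) ⟩
      m * ∣ a ∷ [] ∣ l + ∣ b ∷ [] ∣ l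
        ≡⟨ subst2-b G (∣ a ∷ [] ∣ l) (m * ∣ a ∷ [] ∣ l + ∣ b ∷ [] ∣ l) Gi ⟨
      gapSeq G (∣_∣ l) (a ∷ []) (b ∷ []) m i                        ∎
      where
      open ≡-Reasoning
      length-aᵐb : length (replicate m a ++ b ∷ []) ≡ m * 1 + 1
      length-aᵐb = trans (length-++ (replicate m a)) (cong (_+ 1) (trans (length-replicate m) (sym (*-identityʳ m))))

  centre-count′ : ∀ l → 2 * 0 + ∣ replicate m a ∣ l + 1 ≡ suc m * ∣ a ∷ [] ∣ l + ∣ b ∷ [] ∣ l
  centre-count′ a = trans (cong (_+ 1) (count-aⁿ-a m)) (trans (+-comm m 1) (sym (trans (+-identityʳ _) (*-identityʳ (suc m)))))
  centre-count′ b = trans (cong (_+ 1) (count-aⁿ-b m)) (cong (_+ 1) (sym (*-zeroʳ (suc m))))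

  pattern′ : OccurrencePattern x (replicate m a) G [] (a ∷ []) (b ∷ []) m
  pattern′ = record
    { prefix = refl ; complete = complete′ ; sound = sound′ ; gap-count = gap-count′ ; centre-count = centre-count′ }

-- Singular words under φ

Ends : Word → Letter → Set
Ends w l = Σ Word λ t → w ≡ t ++ l ∷ []

EmptyOrEnds : Word → Letter → Set
EmptyOrEnds w l = w ≡ [] ⊎ Ends w l

ends-++ : ∀ u {v l} → Ends v l → Ends (u ++ v) l
ends-++ u (t , refl) = u ++ t , sym (++-assoc u t _)

emptyOrEnds-++ : ∀ {u v l} → EmptyOrEnds u l → EmptyOrEnds v l → EmptyOrEnds (u ++ v) l
emptyOrEnds-++ u? (inj₂ v-ends) = inj₂ (ends-++ _ v-ends)
emptyOrEnds-++ {u} u? (inj₁ refl) = subst (λ w → EmptyOrEnds w _) (sym (++-identityʳ u)) u?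

emptyOrEnds-^w : ∀ {x l} k → EmptyOrEnds x l → EmptyOrEnds (x ^w k) l
emptyOrEnds-^w zero x? = inj₁ refl
emptyOrEnds-^w (suc k) x? = emptyOrEnds-++ x? (emptyOrEnds-^w k x?)

stdSh-odd-ends : ∀ cf m → isEven m ≡ false → Ends (stdSh cf m) a
stdSh-odd-ends cf (suc zero) _ = [] , refl
stdSh-odd-ends cf (suc (suc m)) odd = ends-++ _ (stdSh-odd-ends cf m odd)

stdSh-even-ends : ∀ cf m → isEven m ≡ true → Σ Word λ z → stdSh cf m ≡ z ++ b ∷ [] × EmptyOrEnds z a
stdSh-even-ends cf zero _ = [] , refl , inj₁ refl
stdSh-even-ends cf (suc (suc m)) even with stdSh-even-ends cf m even
... | z , eq , z? = X ^w k ++ z , trans (cong (X ^w k ++_) eq) (sym (++-assoc (X ^w k) z _)) ,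
                      emptyOrEnds-++ (emptyOrEnds-^w k (inj₂ (stdSh-odd-ends cf (suc m) (trans (isEven-suc m) (cong not even))))) z?
  where
  X = stdSh cf (suc m)
  k = stdExp cf (suc m)

s-shift : ∀ d m → stdSh (alphaCF d) (suc m) ≡ φ (d 1) (stdSh (alphaCF (d ∘ suc)) m)
s-shift d m = trans (stdSh-φ (alphaCF d) m) (cong (φ (d 1)) (stdSh-cong tail≗ m))
  where
  tail≗ : tailCF (alphaCF d) ≗⁺ alphaCF (d ∘ suc)
  tail≗ zero = refl
  tail≗ (suc j) = refl

record ImageR (e : ℕ) (X X′ : Word) : Set where
  constructor imageR
  field ≡imageR : X ≡ φ e X′ ++ replicate e a
open ImageR

record ImageL (e : ℕ) (X X′ : Word) : Set where
  constructor imageL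
  field ≡imageL : replicate e a ++ X ≡ φ e X′
open ImageL

ImageRᵇ : ℕ → Word → Word → Set
ImageRᵇ e X X′ = Σ Word λ t → X′ ≡ b ∷ t × X ≡ a ∷ (φ e t ++ replicate e a)

ImageLᵃ : ℕ → Word → Word → Set
ImageLᵃ e X X′ = Σ Word λ t → X′ ≡ a ∷ t × X ≡ b ∷ φ e t × EmptyOrEnds t a

ImageRᵇ⇒ImageR : ∀ {e X X′} → ImageRᵇ e X X′ → ImageR e X X′
ImageRᵇ⇒ImageR (t , refl , refl) = imageR refl

ImageLᵃ⇒ImageL : ∀ {e X X′} → ImageLᵃ e X X′ → ImageL e X X′
ImageLᵃ⇒ImageL {e} (t , refl , refl , _) = imageL (sym (++-assoc (replicate e a) (b ∷ []) _))

SingularPairImage : ℕ → Word → Word → Word → Word → Set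
SingularPairImage e W V W′ V′ = (ImageRᵇ e W W′ × ImageLᵃ e V V′) ⊎ (ImageLᵃ e W W′ × ImageRᵇ e V V′)

-- sₙ ends with a exactly when n is even, which decides whether w or v absorbs the factor aᵉ.
singular-φ-even : ∀ d M → isEven M ≡ true →
                  ImageRᵇ (d 1) (w d (suc M)) (w (d ∘ suc) M) × ImageLᵃ (d 1) (vSh d (suc M)) (vSh (d ∘ suc) M)
singular-φ-even d M parity = w-image , v-image
  where
  e = d 1
  S′ = s (d ∘ suc) M
  E = d (2 + M) ∸ 1
  odd-suc : isEven (suc M) ≡ false
  odd-suc = trans (isEven-suc M) (cong not parity)
  S′-ends = stdSh-odd-ends (alphaCF (d ∘ suc)) (suc M) odd-suc
  t = proj₁ S′-ends
  Z′-ends = stdSh-even-ends (alphaCF (d ∘ suc)) M parity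
  z = proj₁ Z′-ends
  w-image : ImageRᵇ e (w d (suc M)) (w (d ∘ suc) M)
  w-image = t , cong₂ _∷_ (if-true b a parity) (trans (cong dropLast (proj₂ S′-ends)) (dropLast-snoc t a))
              , cong₂ _∷_ (if-false b a odd-suc)
                  (trans (cong dropLast (trans (s-shift d (suc M)) (trans (cong (φ e) (proj₂ S′-ends)) (φ-snoc-a e t)))) (dropLast-snoc _ b))
  v-image : ImageLᵃ e (vSh d (suc M)) (vSh (d ∘ suc) M)
  v-image = S′ ^w E ++ z
          , cong₂ _∷_ (if-true a b parity) (cong (S′ ^w E ++_) (trans (cong dropLast (proj₁ (proj₂ Z′-ends))) (dropLast-snoc z b)))
          , cong₂ _∷_ (if-false a b odd-suc) body
          , emptyOrEnds-++ (emptyOrEnds-^w E (inj₂ S′-ends)) (proj₂ (proj₂ Z′-ends))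
    where
    body : s d (suc M) ^w E ++ dropLast (stdSh (alphaCF d) (suc M)) ≡ φ e (S′ ^w E ++ z)
    body = begin
      s d (suc M) ^w E ++ dropLast (stdSh (alphaCF d) (suc M))
        ≡⟨ cong₂ (λ p q → p ^w E ++ dropLast q) (s-shift d (suc M)) (trans (s-shift d M) (cong (φ e) (proj₁ (proj₂ Z′-ends)))) ⟩
      φ e S′ ^w E ++ dropLast (φ e (z ++ b ∷ []))
        ≡⟨ cong₂ _++_ (sym (φ-^w e S′ E)) (trans (cong dropLast (φ-snoc-b e z)) (dropLast-snoc _ a)) ⟩
      φ e (S′ ^w E) ++ φ e z
        ≡⟨ φ-++ e (S′ ^w E) z ⟨
      φ e (S′ ^w E ++ z) ∎
      where open ≡-Reasoning

singular-φ-odd : ∀ d M → isEven M ≡ false →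
                 ImageLᵃ (d 1) (w d (suc M)) (w (d ∘ suc) M) × ImageRᵇ (d 1) (vSh d (suc M)) (vSh (d ∘ suc) M)
singular-φ-odd d M parity = w-image , v-image
  where
  e = d 1
  S′ = s (d ∘ suc) M
  E = d (2 + M) ∸ 1
  even-suc : isEven (suc M) ≡ true
  even-suc = trans (isEven-suc M) (cong not parity)
  S′-ends = stdSh-even-ends (alphaCF (d ∘ suc)) (suc M) even-suc
  t = proj₁ S′-ends
  Z′-ends = stdSh-odd-ends (alphaCF (d ∘ suc)) M parity
  z = proj₁ Z′-ends
  w-image : ImageLᵃ e (w d (suc M)) (w (d ∘ suc) M)
  w-image = t , cong₂ _∷_ (if-false b a parity) (trans (cong dropLast (proj₁ (proj₂ S′-ends))) (dropLast-snoc t b))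
              , cong₂ _∷_ (if-true b a even-suc)
                  (trans (cong dropLast (trans (s-shift d (suc M)) (trans (cong (φ e) (proj₁ (proj₂ S′-ends))) (φ-snoc-b e t)))) (dropLast-snoc _ a))
              , proj₂ (proj₂ S′-ends)
  v-image : ImageRᵇ e (vSh d (suc M)) (vSh (d ∘ suc) M)
  v-image = S′ ^w E ++ z
          , cong₂ _∷_ (if-false a b parity) (cong (S′ ^w E ++_) (trans (cong dropLast (proj₂ Z′-ends)) (dropLast-snoc z a)))
          , cong₂ _∷_ (if-true a b even-suc) body
    where
    body : s d (suc M) ^w E ++ dropLast (stdSh (alphaCF d) (suc M)) ≡ φ e (S′ ^w E ++ z) ++ replicate e a
    body = begin
      s d (suc M) ^w E ++ dropLast (stdSh (alphaCF d) (suc M))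
        ≡⟨ cong₂ (λ p q → p ^w E ++ dropLast q) (s-shift d (suc M)) (trans (s-shift d M) (cong (φ e) (proj₂ Z′-ends))) ⟩
      φ e S′ ^w E ++ dropLast (φ e (z ++ a ∷ []))
        ≡⟨ cong₂ _++_ (sym (φ-^w e S′ E)) (trans (cong dropLast (φ-snoc-a e z)) (dropLast-snoc _ b)) ⟩
      φ e (S′ ^w E) ++ (φ e z ++ replicate e a)
        ≡⟨ ++-assoc (φ e (S′ ^w E)) _ _ ⟨
      (φ e (S′ ^w E) ++ φ e z) ++ replicate e a
        ≡⟨ cong (_++ replicate e a) (φ-++ e (S′ ^w E) z) ⟨
      φ e (S′ ^w E ++ z) ++ replicate e a ∎
      where open ≡-Reasoning

singular-φ : ∀ d M → SingularPairImage (d 1) (w d (suc M)) (vSh d (suc M)) (w (d ∘ suc) M) (vSh (d ∘ suc) M)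
singular-φ d M = byParity (isEven M) refl
  where
  byParity : ∀ c → isEven M ≡ c → SingularPairImage (d 1) (w d (suc M)) (vSh d (suc M)) (w (d ∘ suc) M) (vSh (d ∘ suc) M)
  byParity true parity = inj₁ (singular-φ-even d M parity)
  byParity false parity = inj₂ (singular-φ-odd d M parity)

StartsB : Word → Set
StartsB F = Σ Word λ z → F ≡ b ∷ z

imageR⇒lift : ∀ {e F F′} → ImageR e F F′ → Lift e F F′
imageR⇒lift {F = F} img = 0 , trans (++-identityʳ F) (≡imageR img) , inj₁ refl

imageL⇒lift : ∀ {e F F′} → ImageL e F F′ → StartsB F → Ends F b → Lift e F F′
imageL⇒lift {e} {F} img (z , F≡) (z′ , F≡′) =
  e , trans (sym (++-assoc (replicate e a) F _)) (cong (_++ replicate e a) (≡imageL img)) ,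
  inj₂ ((0 , z , F≡ , ≤-refl) , (0 , z′ , F≡′ , ≤-refl))

module _ {e x x′ y y′} (imgx : ImageR e x x′) (imgy : ImageL e y y′) where

  private
    aᵉ = replicate e a

  imageR-alternate : ∀ k → ImageR e ((x ++ y) ^w k ++ x) ((x′ ++ y′) ^w k ++ x′)
  imageL-alternate : ∀ k → ImageL e ((y ++ x) ^w k ++ y) ((y′ ++ x′) ^w k ++ y′)

  imageR-alternate zero = imgx
  imageR-alternate (suc k) = imageR (begin
    ((x ++ y) ++ P) ++ x                             ≡⟨ ++-assoc₄ x y P x ⟩
    x ++ (y ++ (P ++ x))
      ≡⟨ cong₂ (λ p q → p ++ (y ++ q)) (≡imageR imgx) (≡imageR (imageR-alternate k)) ⟩
    (φ e x′ ++ aᵉ) ++ (y ++ (φ e R′ ++ aᵉ))          ≡⟨ ++-assoc (φ e x′) aᵉ _ ⟩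
    φ e x′ ++ (aᵉ ++ (y ++ (φ e R′ ++ aᵉ)))          ≡⟨ cong (φ e x′ ++_) (++-assoc aᵉ y _) ⟨
    φ e x′ ++ ((aᵉ ++ y) ++ (φ e R′ ++ aᵉ))          ≡⟨ cong (λ q → φ e x′ ++ (q ++ (φ e R′ ++ aᵉ))) (≡imageL imgy) ⟩
    φ e x′ ++ (φ e y′ ++ (φ e R′ ++ aᵉ))             ≡⟨ ++-assoc₄ (φ e x′) (φ e y′) (φ e R′) aᵉ ⟨
    ((φ e x′ ++ φ e y′) ++ φ e R′) ++ aᵉ
      ≡⟨ cong (_++ aᵉ) (trans (φ-++ e (x′ ++ y′) R′) (cong (_++ φ e R′) (φ-++ e x′ y′))) ⟨
    φ e ((x′ ++ y′) ++ R′) ++ aᵉ                     ≡⟨ cong (λ q → φ e q ++ aᵉ) (++-assoc (x′ ++ y′) P′ x′) ⟨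
    φ e (((x′ ++ y′) ++ P′) ++ x′) ++ aᵉ             ∎)
    where
    open ≡-Reasoning
    P = (x ++ y) ^w k
    P′ = (x′ ++ y′) ^w k
    R′ = P′ ++ x′

  imageL-alternate zero = imgy
  imageL-alternate (suc k) = imageL (begin
    aᵉ ++ (((y ++ x) ++ P) ++ y)                     ≡⟨ cong (aᵉ ++_) (++-assoc₄ y x P y) ⟩
    aᵉ ++ (y ++ (x ++ (P ++ y)))                     ≡⟨ ++-assoc aᵉ y _ ⟨
    (aᵉ ++ y) ++ (x ++ (P ++ y))                     ≡⟨ cong₂ (λ p q → p ++ (q ++ (P ++ y))) (≡imageL imgy) (≡imageR imgx) ⟩
    φ e y′ ++ ((φ e x′ ++ aᵉ) ++ (P ++ y))           ≡⟨ cong (φ e y′ ++_) (++-assoc (φ e x′) aᵉ _) ⟩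
    φ e y′ ++ (φ e x′ ++ (aᵉ ++ (P ++ y)))           ≡⟨ cong (λ q → φ e y′ ++ (φ e x′ ++ q)) (≡imageL (imageL-alternate k)) ⟩
    φ e y′ ++ (φ e x′ ++ φ e R′)                     ≡⟨ ++-assoc (φ e y′) (φ e x′) _ ⟨
    (φ e y′ ++ φ e x′) ++ φ e R′                     ≡⟨ trans (φ-++ e (y′ ++ x′) R′) (cong (_++ φ e R′) (φ-++ e y′ x′)) ⟨
    φ e ((y′ ++ x′) ++ R′)                           ≡⟨ cong (φ e) (++-assoc (y′ ++ x′) P′ y′) ⟨
    φ e (((y′ ++ x′) ++ P′) ++ y′)                   ∎)
    where
    open ≡-Reasoning
    P = (y ++ x) ^w k
    P′ = (y′ ++ x′) ^w k
    R′ = P′ ++ y′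

startsB-alternate : ∀ {y} x k → StartsB y → StartsB ((y ++ x) ^w k ++ y)
startsB-alternate x zero y-starts = y-starts
startsB-alternate {y} x (suc k) (z , refl) = ((z ++ x) ++ (y ++ x) ^w k) ++ y , refl

endsB-alternate : ∀ {y} x k → Ends y b → Ends ((y ++ x) ^w k ++ y) b
endsB-alternate {y} x k = ends-++ ((y ++ x) ^w k)

imageLᵃ-startsB : ∀ {e X X′} → ImageLᵃ e X X′ → StartsB X
imageLᵃ-startsB {e} (t , _ , refl , _) = φ e t , refl

imageLᵃ-endsB : ∀ {e X X′} → ImageLᵃ e X X′ → Ends X b
imageLᵃ-endsB (t , _ , refl , inj₁ refl) = [] , refl
imageLᵃ-endsB {e} (t , _ , refl , inj₂ (s , refl)) = b ∷ (φ e s ++ replicate e a) , cong (b ∷_) (φ-snoc-a e s)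

frame : Word → Word → Word
frame t U = t ++ U ++ reverse t

length-frame : ∀ t U → length (frame t U) ≡ 2 * length t + length U
length-frame t U = begin
  length (t ++ U ++ reverse t)                 ≡⟨ length-++ t ⟩
  length t + length (U ++ reverse t)           ≡⟨ cong (length t +_) (length-++ U) ⟩
  length t + (length U + length (reverse t))   ≡⟨ cong (λ k → length t + (length U + k)) (length-reverse t) ⟩
  length t + (length U + length t)             ≡⟨ rearrange (length t) (length U) ⟩
  2 * length t + length U                      ∎
  where
  open ≡-Reasoning
  rearrange : ∀ t U → t + (U + t) ≡ 2 * t + U
  rearrange = solve-∀

frame-++ : ∀ t v U → frame (t ++ v) U ≡ t ++ frame v U ++ reverse t
frame-++ t v U = begin
  (t ++ v) ++ U ++ reverse (t ++ v)              ≡⟨ cong (λ z → (t ++ v) ++ U ++ z) (reverse-++ t v) ⟩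
  (t ++ v) ++ U ++ reverse v ++ reverse t        ≡⟨ ++-assoc t v _ ⟩
  t ++ v ++ U ++ reverse v ++ reverse t          ≡⟨ cong (λ z → t ++ v ++ z) (++-assoc U (reverse v) _) ⟨
  t ++ v ++ (U ++ reverse v) ++ reverse t        ≡⟨ cong (t ++_) (++-assoc v (U ++ reverse v) _) ⟨
  t ++ frame v U ++ reverse t                    ∎
  where open ≡-Reasoning

suffix⇒drop₁ : ∀ v W → Suffix v W → v ≢ W → Σ Word λ t → drop 1 W ≡ t ++ v
suffix⇒drop₁ v W ([] , eq) v≢W = ⊥-elim (v≢W eq)
suffix⇒drop₁ v W (l ∷ t , refl) _ = t , refl

φ-frame : ∀ e t U′ → φ e t ++ φ e U′ ++ replicate e a ++ reverse (φ e t) ≡ φ e (frame t U′) ++ replicate e a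
φ-frame e t U′ = begin
  φ e t ++ φ e U′ ++ aᵉ ++ reverse (φ e t)         ≡⟨ cong (λ q → φ e t ++ φ e U′ ++ q) (reverse-φ e t) ⟩
  φ e t ++ φ e U′ ++ φ e (reverse t) ++ aᵉ         ≡⟨ ++-assoc₄ (φ e t) (φ e U′) (φ e (reverse t)) aᵉ ⟨
  ((φ e t ++ φ e U′) ++ φ e (reverse t)) ++ aᵉ     ≡⟨ cong (_++ aᵉ) (++-assoc (φ e t) (φ e U′) _) ⟩
  (φ e t ++ φ e U′ ++ φ e (reverse t)) ++ aᵉ
    ≡⟨ cong (_++ aᵉ) (trans (φ-++ e t _) (cong (φ e t ++_) (φ-++ e U′ (reverse t)))) ⟨
  φ e (frame t U′) ++ aᵉ                           ∎
  where
  open ≡-Reasoning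
  aᵉ = replicate e a

imageR-frame-Rᵇ : ∀ {e v v′ U U′} → ImageRᵇ e v v′ → ImageL e U U′ →
                  ImageR e (frame (drop 1 v) U) (frame (drop 1 v′) U′)
imageR-frame-Rᵇ {e} {U = U} {U′} (t , refl , refl) img = imageR (begin
  (φ e t ++ aᵉ) ++ U ++ reverse (φ e t ++ aᵉ)          ≡⟨ cong (λ q → (φ e t ++ aᵉ) ++ U ++ q) (reverse-++ (φ e t) aᵉ) ⟩
  (φ e t ++ aᵉ) ++ U ++ reverse aᵉ ++ reverse (φ e t)
    ≡⟨ cong (λ q → (φ e t ++ aᵉ) ++ U ++ q ++ reverse (φ e t)) (reverse-replicate e a) ⟩
  (φ e t ++ aᵉ) ++ U ++ aᵉ ++ reverse (φ e t)          ≡⟨ ++-assoc (φ e t) aᵉ _ ⟩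
  φ e t ++ aᵉ ++ U ++ aᵉ ++ reverse (φ e t)            ≡⟨ cong (φ e t ++_) (++-assoc aᵉ U _) ⟨
  φ e t ++ (aᵉ ++ U) ++ aᵉ ++ reverse (φ e t)          ≡⟨ cong (λ q → φ e t ++ q ++ aᵉ ++ reverse (φ e t)) (≡imageL img) ⟩
  φ e t ++ φ e U′ ++ aᵉ ++ reverse (φ e t)             ≡⟨ φ-frame e t U′ ⟩
  φ e (frame t U′) ++ aᵉ                               ∎)
  where
  open ≡-Reasoning
  aᵉ = replicate e a

imageR-frame-Lᵃ : ∀ {e v v′ U U′} → ImageLᵃ e v v′ → ImageR e U U′ →
                  ImageR e (frame (drop 1 v) U) (frame (drop 1 v′) U′)
imageR-frame-Lᵃ {e} {U = U} {U′} (t , refl , refl , _) img = imageR (begin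
  φ e t ++ U ++ reverse (φ e t)                        ≡⟨ cong (λ q → φ e t ++ q ++ reverse (φ e t)) (≡imageR img) ⟩
  φ e t ++ (φ e U′ ++ aᵉ) ++ reverse (φ e t)           ≡⟨ cong (φ e t ++_) (++-assoc (φ e U′) aᵉ _) ⟩
  φ e t ++ φ e U′ ++ aᵉ ++ reverse (φ e t)             ≡⟨ φ-frame e t U′ ⟩
  φ e (frame t U′) ++ aᵉ                               ∎)
  where
  open ≡-Reasoning
  aᵉ = replicate e a

-- The longest palindromes v U ṽ and v Ū ṽ allowed in the theorem: v is v_{n−2}, resp. w_{n−1},
-- without its first letter.
Uᵐᵃˣ : (ℕ → ℕ) → ℕ → ℕ → Word
Uᵐᵃˣ d n k = frame (drop 1 (vSh d (n ∸ 1))) (U d n k)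

Ūᵐᵃˣ : (ℕ → ℕ) → ℕ → ℕ → Word
Ūᵐᵃˣ d n k = frame (drop 1 (w d (n ∸ 1))) (Ubar d n k)

lift-U : ∀ M d k → Lift (d 1) (U d (2 + M) k) (U (d ∘ suc) (suc M) k)
lift-U M d k with singular-φ d M
... | inj₁ (wR , vL) = imageR⇒lift (imageR-alternate (ImageRᵇ⇒ImageR wR) (ImageLᵃ⇒ImageL vL) k)
... | inj₂ (wL , vR) = imageL⇒lift (imageL-alternate (ImageRᵇ⇒ImageR vR) (ImageLᵃ⇒ImageL wL) k)
                         (startsB-alternate (vSh d (suc M)) k (imageLᵃ-startsB wL)) (endsB-alternate (vSh d (suc M)) k (imageLᵃ-endsB wL))

lift-Ubar : ∀ M d k → Lift (d 1) (Ubar d (2 + M) k) (Ubar (d ∘ suc) (suc M) k)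
lift-Ubar M d k with singular-φ d M
... | inj₁ (wR , vL) = imageL⇒lift (imageL-alternate (ImageRᵇ⇒ImageR wR) (ImageLᵃ⇒ImageL vL) k)
                         (startsB-alternate (w d (suc M)) k (imageLᵃ-startsB vL)) (endsB-alternate (w d (suc M)) k (imageLᵃ-endsB vL))
... | inj₂ (wL , vR) = imageR⇒lift (imageR-alternate (ImageRᵇ⇒ImageR vR) (ImageLᵃ⇒ImageL wL) k)

lift-Uᵐᵃˣ : ∀ M d k → Lift (d 1) (Uᵐᵃˣ d (2 + M) k) (Uᵐᵃˣ (d ∘ suc) (suc M) k)
lift-Uᵐᵃˣ M d k with singular-φ d M
... | inj₁ (wR , vL) = imageR⇒lift (imageR-frame-Lᵃ vL (imageR-alternate (ImageRᵇ⇒ImageR wR) (ImageLᵃ⇒ImageL vL) k))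
... | inj₂ (wL , vR) = imageR⇒lift (imageR-frame-Rᵇ vR (imageL-alternate (ImageRᵇ⇒ImageR vR) (ImageLᵃ⇒ImageL wL) k))

lift-Ūᵐᵃˣ : ∀ M d k → Lift (d 1) (Ūᵐᵃˣ d (2 + M) k) (Ūᵐᵃˣ (d ∘ suc) (suc M) k)
lift-Ūᵐᵃˣ M d k with singular-φ d M
... | inj₁ (wR , vL) = imageR⇒lift (imageR-frame-Rᵇ wR (imageL-alternate (ImageRᵇ⇒ImageR wR) (ImageLᵃ⇒ImageL vL) k))
... | inj₂ (wL , vR) = imageR⇒lift (imageR-frame-Lᵃ wL (imageR-alternate (ImageRᵇ⇒ImageR vR) (ImageLᵃ⇒ImageL wL) k))

lift-frame-aᵉ⁻¹ : ∀ {e F F′} → 1 ≤ e → ImageL e F F′ → StartsB F → Ends F b →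
                  Lift e (frame (replicate (e ∸ 1) a) F) F′
lift-frame-aᵉ⁻¹ {suc e′} {F} {F′} _ img (z , F≡) (z′ , F≡′) =
  1 , equation , inj₂ ((e′ , z ++ reverse aᵉ′ , starts , ≤-reflexive (+-comm e′ 1)) ,
                       (e′ , aᵉ′ ++ z′ , ends , ≤-reflexive (+-comm e′ 1)))
  where
  aᵉ′ = replicate e′ a
  aᵉ = replicate (suc e′) a
  starts : frame aᵉ′ F ≡ aᵉ′ ++ b ∷ z ++ reverse aᵉ′
  starts = cong (λ q → aᵉ′ ++ q ++ reverse aᵉ′) F≡
  ends : frame aᵉ′ F ≡ (aᵉ′ ++ z′) ++ b ∷ aᵉ′
  ends = begin
    aᵉ′ ++ F ++ reverse aᵉ′                 ≡⟨ cong₂ (λ p q → aᵉ′ ++ p ++ q) F≡′ (reverse-replicate e′ a) ⟩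
    aᵉ′ ++ (z′ ++ b ∷ []) ++ aᵉ′            ≡⟨ cong (aᵉ′ ++_) (++-assoc z′ (b ∷ []) aᵉ′) ⟩
    aᵉ′ ++ z′ ++ b ∷ aᵉ′                    ≡⟨ ++-assoc aᵉ′ z′ _ ⟨
    (aᵉ′ ++ z′) ++ b ∷ aᵉ′                  ∎
    where open ≡-Reasoning
  equation : a ∷ (frame aᵉ′ F ++ a ∷ []) ≡ φ (suc e′) F′ ++ aᵉ
  equation = begin
    a ∷ ((aᵉ′ ++ F ++ reverse aᵉ′) ++ a ∷ [])     ≡⟨ cong (λ q → a ∷ ((aᵉ′ ++ F ++ q) ++ a ∷ [])) (reverse-replicate e′ a) ⟩
    a ∷ ((aᵉ′ ++ F ++ aᵉ′) ++ a ∷ [])             ≡⟨ cong (a ∷_) (trans (++-assoc aᵉ′ _ _) (cong (aᵉ′ ++_) (++-assoc F aᵉ′ _))) ⟩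
    a ∷ (aᵉ′ ++ F ++ aᵉ′ ++ a ∷ [])               ≡⟨ cong (λ q → a ∷ (aᵉ′ ++ F ++ q)) (replicate-suc-snoc e′ a) ⟨
    aᵉ ++ F ++ aᵉ                                 ≡⟨ ++-assoc aᵉ F aᵉ ⟨
    (aᵉ ++ F) ++ aᵉ                               ≡⟨ cong (_++ aᵉ) (≡imageL img) ⟩
    φ (suc e′) F′ ++ aᵉ                           ∎
    where open ≡-Reasoning

module LevelOne (d : ℕ → ℕ) (d₁≥1 : 1 ≤ d 1) (k : ℕ) where

  e = d 1

  drop₁v₀ : drop 1 (vSh d 0) ≡ replicate (e ∸ 1) a
  drop₁v₀ = trans (++-identityʳ _) (a^w≡replicate (e ∸ 1))

  v₀≡aᵉ : vSh d 0 ≡ replicate e a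
  v₀≡aᵉ = trans (cong (a ∷_) drop₁v₀) (cong (λ n → replicate n a) (m+[n∸m]≡n d₁≥1))

  v₀-image : ImageR e (vSh d 0) []
  v₀-image = imageR v₀≡aᵉ

  w₀-image : ImageL e (b ∷ []) (a ∷ [])
  w₀-image = imageL (sym (++-identityʳ _))

  U-image : ImageL e (U d 1 k) ((a ∷ []) ^w k ++ a ∷ [])
  U-image = imageL-alternate v₀-image w₀-image k

  U-startsB : StartsB (U d 1 k)
  U-startsB = startsB-alternate (vSh d 0) k ([] , refl)

  U-endsB : Ends (U d 1 k) b
  U-endsB = endsB-alternate (vSh d 0) k ([] , refl)

  Ubar-image : ImageR e (Ubar d 1 k) (replicate k a)
  Ubar-image = subst (ImageR e (Ubar d 1 k)) (trans (++-identityʳ _) (a^w≡replicate k)) (imageR-alternate v₀-image w₀-image k)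

  aᵏ⁺¹ : (a ∷ []) ^w k ++ a ∷ [] ≡ replicate (k + 1) a
  aᵏ⁺¹ = trans (cong (_++ a ∷ []) (a^w≡replicate k)) (sym (replicate-+ k 1 a))

  lift-U₁ : Lift e (U d 1 k) (replicate (k + 1) a)
  lift-U₁ = subst (Lift e (U d 1 k)) aᵏ⁺¹ (imageL⇒lift U-image U-startsB U-endsB)

  lift-Ubar₁ : Lift e (Ubar d 1 k) (replicate k a)
  lift-Ubar₁ = imageR⇒lift Ubar-image

  lift-Ūᵐᵃˣ₁ : Lift e (Ūᵐᵃˣ d 1 k) (replicate k a)
  lift-Ūᵐᵃˣ₁ = imageR⇒lift {F′ = replicate k a} (imageR (trans (++-identityʳ (Ubar d 1 k)) (≡imageR Ubar-image)))

  lift-Uᵐᵃˣ₁ : Lift e (Uᵐᵃˣ d 1 k) (replicate (k + 1) a)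
  lift-Uᵐᵃˣ₁ = subst₂ (Lift e) (cong (λ t → frame t (U d 1 k)) (sym drop₁v₀)) aᵏ⁺¹ (lift-frame-aᵉ⁻¹ d₁≥1 U-image U-startsB U-endsB)

Admissible : (ℕ → ℕ) → Set
Admissible d = ∀ i → 1 ≤ i → 1 ≤ d i

admissible-∘suc : ∀ {d} → Admissible d → Admissible (d ∘ suc)
admissible-∘suc adm i _ = adm (suc i) (s≤s z≤n)

alphaCF-valid : ∀ {d} → Admissible d → ValidCF (alphaCF d)
alphaCF-valid adm zero = s≤s z≤n
alphaCF-valid adm (suc j) = adm (2 + j) (s≤s z≤n)

cα-isImage : ∀ d → Admissible d → IsImage (d 1) (cα (d ∘ suc)) (cα d)
cα-isImage d adm = IsImage-cong (charWord-cong tail≗) (λ _ → refl) (charWord-isImage (alphaCF-valid adm))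
  where
  tail≗ : tailCF (alphaCF d) ≗⁺ alphaCF (d ∘ suc)
  tail≗ zero = refl
  tail≗ (suc j) = refl

cα-noBB : ∀ d → Admissible d → NoBB (cα d)
cα-noBB d adm = image-noBB (cα-isImage d adm) (adm 1 (s≤s z≤n))

-- gapCF d n m = [0; d_{n+1}+1−m, d_{n+2}, …], the paper's α_{n,1−m} for n ≥ 1 and α_{0,−m} for n = 0.
gapCF : (ℕ → ℕ) → ℕ → ℕ → ℕ → ℕ
gapCF d n m zero = 0
gapCF d n m (suc zero) = suc (d (suc n)) ∸ m
gapCF d n m (suc (suc j)) = d (n + suc (suc j))

gapCF-valid : ∀ {d} → Admissible d → ∀ n m → m ≤ d (suc n) → ValidCF (gapCF d n m)
gapCF-valid adm n m m≤ zero = ≤-trans (s≤s z≤n) (≤-reflexive (sym (+-∸-assoc 1 m≤)))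
gapCF-valid adm n m m≤ (suc j) = adm (n + suc (suc j)) (≤-trans (s≤s z≤n) (≤-reflexive (sym (+-suc n (suc j)))))

gapCF-∘suc : ∀ d n m → gapCF d (suc n) m ≗⁺ gapCF (d ∘ suc) n m
gapCF-∘suc d n m zero = refl
gapCF-∘suc d n m (suc j) = refl

power-pattern : ∀ d → Admissible d → ∀ m → m ≤ d 1 → ∀ G → (∀ i → G i ≡ charWord (gapCF d 0 m) i) →
                OccurrencePattern (cα d) (replicate m a) G [] (a ∷ []) (b ∷ []) m
power-pattern d adm m m≤ G G≗ =
  PowerPattern.pattern′ (cα-isImage d adm) (cα-noBB (d ∘ suc) (admissible-∘suc adm)) G-image m≤
  where
  tail≗ : tailCF (gapCF d 0 m) ≗⁺ alphaCF (d ∘ suc)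
  tail≗ zero = refl
  tail≗ (suc j) = refl
  exponent : suc (d 1) ∸ m ∸ 1 ≡ d 1 ∸ m
  exponent = trans (∸-+-assoc (suc (d 1)) m 1) (cong (suc (d 1) ∸_) (+-comm m 1))
  G-image : IsImage (d 1 ∸ m) (cα (d ∘ suc)) G
  G-image = subst (λ f → IsImage f (cα (d ∘ suc)) G) exponent
              (IsImage-cong (charWord-cong tail≗) (λ i → sym (G≗ i)) (charWord-isImage (gapCF-valid adm 0 m m≤)))

lift-pattern : ∀ d → Admissible d → ∀ N {u′ G P′ m} →
               OccurrencePattern (cα (d ∘ suc)) u′ G P′ (s (d ∘ suc) N) (stdSh (alphaCF (d ∘ suc)) N) m →
               ∀ u → Lift (d 1) u u′ → Σ Word λ P → OccurrencePattern (cα d) u G P (s d (suc N)) (s d N) m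
lift-pattern d adm N {G = G} {P′} {m} pat u lift =
  P , subst₂ (λ X Y → OccurrencePattern (cα d) u G P X Y m) (sym (s-shift d (suc N))) (sym (s-shift d N))
             (Lifting.pattern′ e≥1 im noBB pat u lift)
  where
  e≥1 = adm 1 (s≤s z≤n)
  im = cα-isImage d adm
  noBB = cα-noBB (d ∘ suc) (admissible-∘suc adm)
  P = Lifting.P e≥1 im noBB pat u lift

charWord-gapCF-∘suc : ∀ d n m {G : InfWord} → (∀ i → G i ≡ charWord (gapCF d (suc n) m) i) →
                      ∀ i → G i ≡ charWord (gapCF (d ∘ suc) n m) i
charWord-gapCF-∘suc d n m G≗ i = trans (G≗ i) (charWord-cong (gapCF-∘suc d n m) i)

family-pattern : (Fam : (ℕ → ℕ) → ℕ → Word) (m : ℕ) →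
  (∀ M d → Lift (d 1) (Fam d (2 + M)) (Fam (d ∘ suc) (suc M))) →
  (∀ d → 1 ≤ d 1 → Lift (d 1) (Fam d 1) (replicate m a)) →
  ∀ N d → Admissible d → m ≤ d (2 + N) → ∀ G → (∀ i → G i ≡ charWord (gapCF d (suc N) m) i) →
  Σ Word λ P → OccurrencePattern (cα d) (Fam d (suc N)) G P (s d (suc N)) (s d N) m
family-pattern Fam m lift-step lift-one zero d adm m≤ G G≗ =
  lift-pattern d adm 0 (power-pattern (d ∘ suc) (admissible-∘suc adm) m m≤ G (charWord-gapCF-∘suc d 0 m G≗))
               (Fam d 1) (lift-one d (adm 1 (s≤s z≤n)))
family-pattern Fam m lift-step lift-one (suc N) d adm m≤ G G≗ =
  lift-pattern d adm (suc N)
    (proj₂ (family-pattern Fam m lift-step lift-one N (d ∘ suc) (admissible-∘suc adm) m≤ G (charWord-gapCF-∘suc d (suc N) m G≗)))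
    (Fam d (2 + N)) (lift-step N d)

-- From enumerations to occurrence numbers

countOcc-none : ∀ x u t k → (∀ j → j < k → ¬ OccursAt x u (t + j)) → countOcc x u (t + k) ≡ countOcc x u t
countOcc-none x u t zero none = cong (countOcc x u) (+-identityʳ t)
countOcc-none x u t (suc k) none rewrite +-suc t k with matches x (t + k) u in eq
... | true = ⊥-elim (none k (n<1+n k) eq)
... | false = trans (+-identityʳ _) (countOcc-none x u t k (λ j j<k → none j (≤-trans j<k (n≤1+n k))))

countOcc-suc : ∀ x u t → OccursAt x u t → countOcc x u (suc t) ≡ suc (countOcc x u t)
countOcc-suc x u t h with matches x t u
countOcc-suc x u t refl | true = +-comm _ 1

record Enumerates (x : InfWord) (u : Word) (p₀ : ℕ) (g : ℕ → ℕ) : Set where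
  field
    gap≥1      : ∀ i → 1 ≤ g i
    exhaustive : ∀ t → OccursAt x u t → Σ ℕ λ i → t ≡ positions p₀ g i
    occurs     : ∀ i → OccursAt x u (positions p₀ g i)
open Enumerates

countOcc-positions : ∀ {x u p₀ g} → Enumerates x u p₀ g → ∀ i → countOcc x u (positions p₀ g i) ≡ i
countOcc-positions {x} {u} {p₀} {g} en zero = countOcc-none x u 0 p₀ none
  where
  none : ∀ j → j < p₀ → ¬ OccursAt x u j
  none j j<p₀ h with exhaustive en j h
  ... | i , refl = <-irrefl refl (≤-trans j<p₀ (positions-≥ p₀ g i))
countOcc-positions {x} {u} {p₀} {g} en (suc i) = begin
  countOcc x u (P + g i)               ≡⟨ cong (countOcc x u) (trans (cong (P +_) (sym (m+[n∸m]≡n (gap≥1 en i)))) (+-suc P _)) ⟩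
  countOcc x u (suc P + (g i ∸ 1))     ≡⟨ countOcc-none x u (suc P) (g i ∸ 1) none ⟩
  countOcc x u (suc P)                 ≡⟨ countOcc-suc x u P (occurs en i) ⟩
  suc (countOcc x u P)                 ≡⟨ cong suc (countOcc-positions en i) ⟩
  suc i                                ∎
  where
  open ≡-Reasoning
  P = positions p₀ g i
  none : ∀ j → j < g i ∸ 1 → ¬ OccursAt x u (suc P + j)
  none j j<g h with exhaustive en _ h
  ... | i′ , eq with <-cmp i′ i
  ... | tri< i′<i _ _ =
    <-irrefl refl (≤-trans (≤-trans (positions-monoʳ-< p₀ g (gap≥1 en) i′<i) (m≤m+n P j)) (≤-trans (n≤1+n _) (≤-reflexive eq)))
  ... | tri≈ _ refl _ = <-irrefl refl (≤-trans (s≤s (m≤m+n P j)) (≤-reflexive eq))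
  ... | tri> _ _ i′>i =
    <-irrefl refl (≤-trans (≤-reflexive (cong suc (sym eq))) (≤-trans before (positions-monoʳ-≤ p₀ g (gap≥1 en) i′>i)))
    where
    before : suc (suc P + j) ≤ P + g i
    before = ≤-trans (≤-reflexive (sym (trans (+-suc P (suc j)) (cong suc (+-suc P j)))))
                     (+-monoʳ-≤ P (≤-trans (s≤s j<g) (≤-reflexive (m+[n∸m]≡n (gap≥1 en i)))))

OccurrenceSequence : InfWord → Word → ℕ → (ℕ → ℕ) → Set
OccurrenceSequence x u p₀ g = Occ x u 1 p₀ × (∀ i p → Occ x u (suc i) p → Occ x u (suc (suc i)) (p + g i))

enumerates⇒occurrenceSequence : ∀ {x u p₀ g} → Enumerates x u p₀ g → OccurrenceSequence x u p₀ g
enumerates⇒occurrenceSequence {x} {u} {p₀} {g} en = (occurs en 0 , cong suc (countOcc-positions en 0)) , next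
  where
  next : ∀ i p → Occ x u (suc i) p → Occ x u (suc (suc i)) (p + g i)
  next i p (h , count) with exhaustive en p h
  ... | j , refl with trans (sym (cong suc (countOcc-positions en j))) count
  ... | refl = occurs en (suc j) , cong suc (countOcc-positions en (suc j))

occurrenceSequence-cong : ∀ {x u p₀ g g′} → (∀ i → g i ≡ g′ i) → OccurrenceSequence x u p₀ g → OccurrenceSequence x u p₀ g′
occurrenceSequence-cong {x} {u} g≗g′ (first , next) =
  first , λ i p h → subst (Occ x u _) (cong (p +_) (g≗g′ i)) (next i p h)

pattern⇒enumerates : ∀ {x u G P X Y m} → OccurrencePattern x u G P X Y m → 1 ≤ length X → 1 ≤ length Y →
                     Enumerates x u (length P) (gapSeq G length X Y m)
pattern⇒enumerates {G = G} {X = X} {Y} {m} pat X≥1 Y≥1 = record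
  { gap≥1 = λ i → subst2-≥ G i X≥1 (≤-trans Y≥1 (m≤n+m _ _)) ; exhaustive = complete pat ; occurs = sound pat }

centre-length : ∀ {x u G P X Y m} → OccurrencePattern x u G P X Y m →
                2 * length P + length u + 2 ≡ suc m * length X + length Y
centre-length {u = u} {P = P} {X} {Y} {m} pat = begin
  2 * length P + length u + 2
    ≡⟨ cong₂ (λ p q → 2 * p + q + 2) (length≡count-a+count-b P) (length≡count-a+count-b u) ⟩
  2 * (∣ P ∣ a + ∣ P ∣ b) + (∣ u ∣ a + ∣ u ∣ b) + 2
    ≡⟨ split (∣ P ∣ a) (∣ P ∣ b) (∣ u ∣ a) (∣ u ∣ b) ⟩
  (2 * ∣ P ∣ a + ∣ u ∣ a + 1) + (2 * ∣ P ∣ b + ∣ u ∣ b + 1)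
    ≡⟨ cong₂ _+_ (centre-count pat a) (centre-count pat b) ⟩
  (suc m * ∣ X ∣ a + ∣ Y ∣ a) + (suc m * ∣ X ∣ b + ∣ Y ∣ b)
    ≡⟨ merge m (∣ X ∣ a) (∣ X ∣ b) (∣ Y ∣ a) (∣ Y ∣ b) ⟩
  suc m * (∣ X ∣ a + ∣ X ∣ b) + (∣ Y ∣ a + ∣ Y ∣ b)
    ≡⟨ cong₂ (λ p q → suc m * p + q) (length≡count-a+count-b X) (length≡count-a+count-b Y) ⟨
  suc m * length X + length Y ∎
  where
  open ≡-Reasoning
  split : ∀ A B C D → 2 * (A + B) + (C + D) + 2 ≡ (2 * A + C + 1) + (2 * B + D + 1)
  split = solve-∀
  merge : ∀ m A B C D → (suc m * A + C) + (suc m * B + D) ≡ suc m * (A + B) + (C + D)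
  merge = solve-∀

frame-enumerates : ∀ {x U pU pM g} t v → Enumerates x U pU g → Enumerates x (frame (t ++ v) U) pM g →
                   2 * pU + length U ≡ 2 * pM + length (frame (t ++ v) U) →
                   Enumerates x (frame v U) (pM + length t) g × 2 * (pM + length t) + length (frame v U) ≡ 2 * pU + length U
frame-enumerates {x} {U} {pU} {pM} {g} t v enU enM centre =
  record { gap≥1 = gap≥1 enU ; exhaustive = exhaustive′ ; occurs = occurs′ } , centre′
  where
  pU≡ : pU ≡ pM + length t + length v
  pU≡ = *-cancelˡ-≡ pU _ 2 (+-cancelʳ-≡ (length U) _ _ (begin
    2 * pU + length U                                  ≡⟨ centre ⟩
    2 * pM + length (frame (t ++ v) U)                 ≡⟨ cong (2 * pM +_) (length-frame (t ++ v) U) ⟩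
    2 * pM + (2 * length (t ++ v) + length U)          ≡⟨ cong (λ k → 2 * pM + (2 * k + length U)) (length-++ t) ⟩
    2 * pM + (2 * (length t + length v) + length U)    ≡⟨ rearrange pM (length t) (length v) (length U) ⟩
    2 * (pM + length t + length v) + length U          ∎))
    where
    open ≡-Reasoning
    rearrange : ∀ p t v U → 2 * p + (2 * (t + v) + U) ≡ 2 * (p + t + v) + U
    rearrange = solve-∀
  exhaustive′ : ∀ s → OccursAt x (frame v U) s → Σ ℕ λ i → s ≡ positions (pM + length t) g i
  exhaustive′ s h with exhaustive enU (s + length v) (proj₁ (occursAt-++⁻ U (reverse v) (proj₂ (occursAt-++⁻ v (U ++ reverse v) h))))
  ... | i , eq =
    i , +-cancelʳ-≡ (length v) s _ (trans eq (trans (cong (λ p → positions p g i) pU≡) (positions-+ˡ (pM + length t) (length v) g i)))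
  occurs′ : ∀ i → OccursAt x (frame v U) (positions (pM + length t) g i)
  occurs′ i = subst (OccursAt x (frame v U)) (sym (positions-+ˡ pM (length t) g i))
    (proj₁ (occursAt-++⁻ (frame v U) (reverse t)
      (proj₂ (occursAt-++⁻ t (frame v U ++ reverse t) (subst (λ z → OccursAt x z (positions pM g i)) (frame-++ t v U) (occurs enM i))))))
  centre′ : 2 * (pM + length t) + length (frame v U) ≡ 2 * pU + length U
  centre′ = begin
    2 * (pM + length t) + length (frame v U)           ≡⟨ cong (2 * (pM + length t) +_) (length-frame v U) ⟩
    2 * (pM + length t) + (2 * length v + length U)    ≡⟨ rearrange (pM + length t) (length v) (length U) ⟩
    2 * (pM + length t + length v) + length U          ≡⟨ cong (λ p → 2 * p + length U) pU≡ ⟨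
    2 * pU + length U                                  ∎
    where
    open ≡-Reasoning
    rearrange : ∀ p v U → 2 * p + (2 * v + U) ≡ 2 * (p + v) + U
    rearrange = solve-∀

framed-occurrences :
  (Fam border : (ℕ → ℕ) → ℕ → Word) (m : ℕ) →
  (∀ M d → Lift (d 1) (Fam d (2 + M)) (Fam (d ∘ suc) (suc M))) →
  (∀ d → 1 ≤ d 1 → Lift (d 1) (Fam d 1) (replicate m a)) →
  (∀ M d → Lift (d 1) (frame (drop 1 (border d (suc M))) (Fam d (2 + M)))
                      (frame (drop 1 (border (d ∘ suc) M)) (Fam (d ∘ suc) (suc M)))) →
  (∀ d → 1 ≤ d 1 → Lift (d 1) (frame (drop 1 (border d 0)) (Fam d 1)) (replicate m a)) →
  ∀ N d → Admissible d → m ≤ d (2 + N) → ∀ G → (∀ i → G i ≡ charWord (gapCF d (suc N) m) i) →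
  ∀ v → Suffix v (border d N) → v ≢ border d N →
  Σ ℕ λ p → OccurrenceSequence (cα d) (frame v (Fam d (suc N))) p (gapSeq G length (s d (suc N)) (s d N) m)
          × 2 * p + length (frame v (Fam d (suc N))) + 2 ≡ suc m * q d (suc N) + q d N
framed-occurrences Fam border m lift lift₁ liftᵐᵃˣ liftᵐᵃˣ₁ N d adm m≤ G G≗ v suffix v≢ =
  length PM + length t , enumerates⇒occurrenceSequence (proj₁ framed) , trans (cong (_+ 2) (proj₂ framed)) (centre-length patU)
  where
  F = Fam d (suc N)
  X≥1 = stdSh-nonempty (alphaCF d) (2 + N)
  Y≥1 = stdSh-nonempty (alphaCF d) (suc N)
  patternU = family-pattern Fam m lift lift₁ N d adm m≤ G G≗
  PU = proj₁ patternU
  patU = proj₂ patternU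
  patternM = family-pattern (λ d n → frame (drop 1 (border d (n ∸ 1))) (Fam d n)) m liftᵐᵃˣ liftᵐᵃˣ₁ N d adm m≤ G G≗
  PM = proj₁ patternM
  patM = proj₂ patternM
  t = proj₁ (suffix⇒drop₁ v (border d N) suffix v≢)
  drop≡ = proj₂ (suffix⇒drop₁ v (border d N) suffix v≢)
  enM : Enumerates (cα d) (frame (t ++ v) F) (length PM) (gapSeq G length (s d (suc N)) (s d N) m)
  enM = subst (λ z → Enumerates (cα d) (frame z F) (length PM) _) drop≡ (pattern⇒enumerates patM X≥1 Y≥1)
  centres : 2 * length PU + length F ≡ 2 * length PM + length (frame (t ++ v) F)
  centres = +-cancelʳ-≡ 2 _ _ (trans (centre-length patU)
              (sym (trans (cong (λ z → 2 * length PM + length (frame z F) + 2) (sym drop≡)) (centre-length patM))))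
  framed = frame-enumerates t v (pattern⇒enumerates patU X≥1 Y≥1) enM centres

open import Data.Integer as ℤ using (+_; -_; _-_)
import Data.Integer.Properties as ℤP

∣+m-+n∣ : ∀ m n → n ≤ m → ℤ.∣ + m ℤ.+ - (+ n) ∣ ≡ m ∸ n
∣+m-+n∣ m n n≤m = cong ℤ.∣_∣ (trans (ℤP.m-n≡m⊖n m n) (ℤP.⊖-≥ n≤m))

alphaCF-suc-+ : ∀ d N j → alphaCF d (suc N + suc j) ≡ d (suc N + suc j)
alphaCF-suc-+ d N j rewrite +-suc N j = refl

cfShift-U : ∀ d N k → k ≤ d (2 + N) → cfShift (alphaCF d) (suc N) (- (+ k)) ≗⁺ gapCF d (suc N) (k + 1)
cfShift-U d N k k≤ zero = trans (∣+m-+n∣ (d (2 + N)) k k≤) (cong (suc (d (2 + N)) ∸_) (+-comm 1 k))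
cfShift-U d N k k≤ (suc j) = alphaCF-suc-+ d N (suc j)

cfShift-Ubar : ∀ d N k → k ≤ suc (d (2 + N)) → cfShift (alphaCF d) (suc N) (+ 1 - + k) ≗⁺ gapCF d (suc N) k
cfShift-Ubar d N k k≤ zero = begin
  ℤ.∣ + x ℤ.+ (+ 1 ℤ.+ - (+ k)) ∣ ≡⟨ cong ℤ.∣_∣ (ℤP.+-assoc (+ x) (+ 1) (- (+ k))) ⟨
  ℤ.∣ + (x + 1) ℤ.+ - (+ k) ∣     ≡⟨ ∣+m-+n∣ (x + 1) k (≤-trans k≤ (≤-reflexive (+-comm 1 x))) ⟩
  x + 1 ∸ k                       ≡⟨ cong (_∸ k) (+-comm x 1) ⟩
  suc x ∸ k                       ∎
  where
  open ≡-Reasoning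
  x = d (2 + N)
cfShift-Ubar d N k k≤ (suc j) = alphaCF-suc-+ d N (suc j)

cfShift-power : ∀ d k → k ≤ suc (d 1) → cfShift (alphaCF d) 0 (- (+ k)) ≗⁺ gapCF d 0 k
cfShift-power d k k≤ zero = ∣+m-+n∣ (suc (d 1)) k k≤
cfShift-power d k k≤ (suc j) = refl

occurrences-U : ∀ d → Admissible d → ∀ u (n k : ℕ) (v : Word) → 1 ≤ n →
  Suffix v (vSh d (n ∸ 1)) → v ≢ vSh d (n ∸ 1) → k + 2 ≤ d (suc n) →
  u ≡ v ++ U d n k ++ reverse v →
  Σ ℕ (λ p → Occ (cα d) u 1 p × 2 * p + length u + 2 ≡ (k + 2) * q d n + q d (n ∸ 1))
  × ((i p : ℕ) → Occ (cα d) u (suc i) p →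
      Occ (cα d) u (suc (suc i))
        (p + subst2 (charWord (cfShift (alphaCF d) n (- (+ k)))) (q d n) ((k + 1) * q d n + q d (n ∸ 1)) i))
occurrences-U d adm u (suc N) k v _ suffix v≢ k+2≤ refl = (p , first , centre′) , next
  where
  G = charWord (cfShift (alphaCF d) (suc N) (- (+ k)))
  k+1≤ : k + 1 ≤ d (2 + N)
  k+1≤ = ≤-trans (+-monoʳ-≤ k (n≤1+n 1)) k+2≤
  occurrences = framed-occurrences (λ d n → U d n k) vSh (k + 1)
    (λ M d → lift-U M d k) (λ d d₁≥1 → LevelOne.lift-U₁ d d₁≥1 k)
    (λ M d → lift-Uᵐᵃˣ M d k) (λ d d₁≥1 → LevelOne.lift-Uᵐᵃˣ₁ d d₁≥1 k)
    N d adm k+1≤ G (charWord-cong (cfShift-U d N k (≤-trans (m≤m+n k 1) k+1≤))) v suffix v≢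
  p = proj₁ occurrences
  first = proj₁ (proj₁ (proj₂ occurrences))
  next = proj₂ (proj₁ (proj₂ occurrences))
  centre′ = trans (proj₂ (proj₂ occurrences)) (cong (λ c → c * q d (suc N) + q d N) (sym (+-suc k 1)))

occurrences-Ubar : ∀ d → Admissible d → ∀ u (n k : ℕ) (v : Word) → 1 ≤ n →
  Suffix v (w d (n ∸ 1)) → v ≢ w d (n ∸ 1) → k + 1 ≤ d (suc n) →
  u ≡ v ++ Ubar d n k ++ reverse v →
  Σ ℕ (λ p → Occ (cα d) u 1 p × 2 * p + length u + 2 ≡ (k + 1) * q d n + q d (n ∸ 1))
  × ((i p : ℕ) → Occ (cα d) u (suc i) p →
      Occ (cα d) u (suc (suc i))
        (p + subst2 (charWord (cfShift (alphaCF d) n (+ 1 - + k))) (q d n) (k * q d n + q d (n ∸ 1)) i))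
occurrences-Ubar d adm u (suc N) k v _ suffix v≢ k+1≤ refl = (p , first , centre′) , next
  where
  G = charWord (cfShift (alphaCF d) (suc N) (+ 1 - + k))
  k≤ : k ≤ d (2 + N)
  k≤ = ≤-trans (m≤m+n k 1) k+1≤
  occurrences = framed-occurrences (λ d n → Ubar d n k) w k
    (λ M d → lift-Ubar M d k) (λ d d₁≥1 → LevelOne.lift-Ubar₁ d d₁≥1 k)
    (λ M d → lift-Ūᵐᵃˣ M d k) (λ d d₁≥1 → LevelOne.lift-Ūᵐᵃˣ₁ d d₁≥1 k)
    N d adm k≤ G (charWord-cong (cfShift-Ubar d N k (≤-trans k≤ (n≤1+n _)))) v suffix v≢
  p = proj₁ occurrences
  first = proj₁ (proj₁ (proj₂ occurrences))
  next = proj₂ (proj₁ (proj₂ occurrences))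
  centre′ = trans (proj₂ (proj₂ occurrences)) (cong (λ c → c * q d (suc N) + q d N) (+-comm 1 k))

occurrences-aᵏ : ∀ d → Admissible d → ∀ u (k : ℕ) → 2 ≤ k → k + 1 ≤ d 1 → u ≡ replicate k a →
  Occ (cα d) u 1 0
  × ((i p : ℕ) → Occ (cα d) u (suc i) p →
      Occ (cα d) u (suc (suc i)) (p + subst2 (charWord (cfShift (alphaCF d) 0 (- (+ k)))) 1 (k + 1) i))
occurrences-aᵏ d adm u k _ k+1≤ refl =
  occurrenceSequence-cong (λ i → cong (λ c → subst2 G 1 (c + 1) i) (*-identityʳ k))
    (enumerates⇒occurrenceSequence (pattern⇒enumerates (power-pattern d adm k k≤ G G≗) (s≤s z≤n) (s≤s z≤n)))
  where
  G = charWord (cfShift (alphaCF d) 0 (- (+ k)))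
  k≤ : k ≤ d 1
  k≤ = ≤-trans (m≤m+n k 1) k+1≤
  G≗ : ∀ i → G i ≡ charWord (gapCF d 0 k) i
  G≗ = charWord-cong (cfShift-power d k (≤-trans k≤ (n≤1+n _)))

corollary5p3 :
  (d : ℕ → ℕ) → (∀ i → 1 ≤ i → 1 ≤ d i) →
  (u : Word) → Palindrome u → Factor u (cα d) → 2 ≤ length u →
  -- (1)
  ((n k : ℕ) (v : Word) → 1 ≤ n →
    Suffix v (vSh d (n ∸ 1)) → v ≢ vSh d (n ∸ 1) → k + 2 ≤ d (suc n) →
    u ≡ v ++ U d n k ++ reverse v →
    Σ ℕ (λ p → Occ (cα d) u 1 p
              × 2 * p + length u + 2 ≡ (k + 2) * q d n + q d (n ∸ 1))
    × ((i p : ℕ) → Occ (cα d) u (suc i) p →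
        Occ (cα d) u (suc (suc i))
          (p + subst2 (charWord (cfShift (alphaCF d) n (- (+ k))))
                      (q d n) ((k + 1) * q d n + q d (n ∸ 1)) i)))
  ×
  -- (2)
  ((n k : ℕ) (v : Word) → 1 ≤ n →
    Suffix v (w d (n ∸ 1)) → v ≢ w d (n ∸ 1) → k + 1 ≤ d (suc n) →
    u ≡ v ++ Ubar d n k ++ reverse v →
    Σ ℕ (λ p → Occ (cα d) u 1 p
              × 2 * p + length u + 2 ≡ (k + 1) * q d n + q d (n ∸ 1))
    × ((i p : ℕ) → Occ (cα d) u (suc i) p →
        Occ (cα d) u (suc (suc i))
          (p + subst2 (charWord (cfShift (alphaCF d) n (+ 1 - + k)))
                      (q d n) (k * q d n + q d (n ∸ 1)) i)))
  ×
  -- moreover: u = a^k with 2 ≤ k ≤ d₁ - 1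
  ((k : ℕ) → 2 ≤ k → k + 1 ≤ d 1 → u ≡ replicate k a →
    Occ (cα d) u 1 0
    × ((i p : ℕ) → Occ (cα d) u (suc i) p →
        Occ (cα d) u (suc (suc i))
          (p + subst2 (charWord (cfShift (alphaCF d) 0 (- (+ k))))
                      1 (k + 1) i)))
corollary5p3 d adm u _ _ _ = occurrences-U d adm u , occurrences-Ubar d adm u , occurrences-aᵏ d adm u
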